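{- Let $D$ be the formal derivative with respect to the grammar $$\{x_1y_1\rightarrow 2tx_1y_1(x_2+y_2),\ x_2\rightarrow 2tx_1y_1,\ y_2\rightarrow 2tx_1y_1,\ t\rightarrow t^2(x_2+y_2)\},$$ i.e. the unique $\mathbb Q$-linear derivation of $\mathbb Q[w,x_2,y_2,t]$, where $w$ stands for the product $x_1y_1$ treated as a single variable, with $D(w)=2tw(x_2+y_2)$, $D(x_2)=2tw$, $D(y_2)=2tw$, $D(t)=t^2(x_2+y_2)$. Then for every $n\ge0$, $$D^n(y_2)=(n+1)!\,t^n\,G_n(x_1,x_2;y_1,y_2)$$ (with $w=x_1y_1$ substituted).
   Context: A formal derivative with respect to a grammar (a set of substitution rules $z\to f_z$ for variables $z$) is the linear operator $D$ satisfying $D(z)=f_z$, $D(uv)=D(u)v+uD(v)$, $D(u+v)=D(u)+D(v)$ and $D(c)=0$ for constants. A plane tree is an unlabeled rooted tree in which the children of every vertex are linearly ordered; $\mathcal P_n$ is the set of plane trees with $n$ edges. A leaf is a vertex with no children, an interior vertex one with at least one child. A leaf is old if it is the leftmost child of its parent (including an only child), young otherwise. For $T\in\mathcal P_n$, $\mathrm{oleaf},\mathrm{yleaf}$ count old and young leaves, $\mathrm{oint}$ counts interior vertices that are parents of old leaves, $\mathrm{yint}$ counts the other interior vertices. For $n\ge1$, $G_n(x_1,x_2;y_1,y_2)=\sum_{T\in\mathcal P_n}x_1^{\mathrm{oleaf}(T)}x_2^{\mathrm{yleaf}(T)}y_1^{\mathrm{oint}(T)}y_2^{\mathrm{yint}(T)}$,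 and $G_0=y_2$. -}

module Defs where

open import Data.Nat using (ℕ; zero; suc; _+_; _*_; _∸_; _≡ᵇ_; _!)

open import Data.Bool using (Bool; true; false; if_then_else_; _∧_)
open import Data.List using (List; []; _∷_; _++_; map; concatMap; replicate; upTo)
open import Data.Product using (_×_; _,_)
open import Function using (_∘_)
open import Relation.Binary.PropositionalEquality using (_≡_)

-- Polynomials with natural-number coefficients over a set of variables,
-- represented as finite lists of terms (coefficient , word); a word is a
-- list of variables standing for their (commutative) product.

Poly : Set → Set
Poly V = List (ℕ × List V)

module _ {V : Set} where

  mulP : Poly V → Poly V → Poly V
  mulP p q = concatMap (λ { (a , u) → map (λ { (b , v) → (a * b , u ++ v) }) q }) p

  scaleP : ℕ → Poly V → Poly V
  scaleP c = map (λ { (a , u) → (c * a , u) })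

  derWord : (V → Poly V) → List V → Poly V
  derWord f [] = []
  derWord f (v ∷ ws) = mulP (f v) ((1 , ws) ∷ []) ++ mulP ((1 , v ∷ []) ∷ []) (derWord f ws)

  derP : (V → Poly V) → Poly V → Poly V
  derP f = concatMap (λ { (c , u) → scaleP c (derWord f u) })

iterate : {A : Set} → (A → A) → ℕ → A → A
iterate g zero a = a
iterate g (suc n) a = g (iterate g n a)

-- The grammar: variables w (= x₁y₁ as a single letter), x₂, y₂, t.

data DVar : Set where
  w x₂ y₂ t : DVar

grammar : DVar → Poly DVar
grammar w  = (2 , t ∷ w ∷ x₂ ∷ []) ∷ (2 , t ∷ w ∷ y₂ ∷ []) ∷ []
grammar x₂ = (2 , t ∷ w ∷ []) ∷ []
grammar y₂ = (2 , t ∷ w ∷ []) ∷ []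
grammar t  = (1 , t ∷ t ∷ x₂ ∷ []) ∷ (1 , t ∷ t ∷ y₂ ∷ []) ∷ []

D : Poly DVar → Poly DVar
D = derP grammar

data Var : Set where
  X₁ Y₁ X₂ Y₂ T : Var

substVar : DVar → List Var
substVar w  = X₁ ∷ Y₁ ∷ []
substVar x₂ = X₂ ∷ []
substVar y₂ = Y₂ ∷ []
substVar t  = T ∷ []

substW : Poly DVar → Poly Var
substW = map (λ { (c , u) → (c , concatMap substVar u) })

eqVar : Var → Var → Bool
eqVar X₁ X₁ = true
eqVar Y₁ Y₁ = true
eqVar X₂ X₂ = true
eqVar Y₂ Y₂ = true
eqVar T T = true
eqVar _ _ = false

count : Var → List Var → ℕ
count v [] = 0
count v (u ∷ us) = (if eqVar v u then 1 else 0) + count v us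

sameMono : List Var → List Var → Bool
sameMono u v = (count X₁ u ≡ᵇ count X₁ v) ∧ (count Y₁ u ≡ᵇ count Y₁ v)
  ∧ (count X₂ u ≡ᵇ count X₂ v) ∧ (count Y₂ u ≡ᵇ count Y₂ v)
  ∧ (count T u ≡ᵇ count T v)

coeff : Poly Var → List Var → ℕ
coeff [] m = 0
coeff ((c , u) ∷ p) m = (if sameMono u m then c else 0) + coeff p m

_≈P_ : Poly Var → Poly Var → Set
p ≈P q = ∀ (m : List Var) → coeff p m ≡ coeff q m

data Tree : Set where
  node : List Tree → Tree

isLeaf : Tree → Bool
isLeaf (node []) = true
isLeaf (node (_ ∷ _)) = false

ind : Bool → ℕ
ind true = 1
ind false = 0

edges : Tree → ℕ
edgesF : List Tree → ℕ
edges (node cs) = edgesF cs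
edgesF [] = 0
edgesF (c ∷ cs) = suc (edges c) + edgesF cs

leafCount : List Tree → ℕ
leafCount [] = 0
leafCount (c ∷ cs) = ind (isLeaf c) + leafCount cs

-- old leaves: leftmost children that are leaves
oleaf : Tree → ℕ
oleafF : List Tree → ℕ
oleaf (node []) = 0
oleaf (node (c ∷ cs)) = ind (isLeaf c) + oleafF (c ∷ cs)
oleafF [] = 0
oleafF (c ∷ cs) = oleaf c + oleafF cs

-- young leaves: non-leftmost children that are leaves
yleaf : Tree → ℕ
yleafF : List Tree → ℕ
yleaf (node []) = 0
yleaf (node (c ∷ cs)) = leafCount cs + yleafF (c ∷ cs)
yleafF [] = 0
yleafF (c ∷ cs) = yleaf c + yleafF cs

-- interior vertices whose leftmost child is a leaf (parents of old leaves)
oint : Tree → ℕ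
ointF : List Tree → ℕ
oint (node []) = 0
oint (node (c ∷ cs)) = ind (isLeaf c) + ointF (c ∷ cs)
ointF [] = 0
ointF (c ∷ cs) = oint c + ointF cs

-- the other interior vertices
yint : Tree → ℕ
yintF : List Tree → ℕ
yint (node []) = 0
yint (node (c ∷ cs)) = (1 ∸ ind (isLeaf c)) + yintF (c ∷ cs)
yintF [] = 0
yintF (c ∷ cs) = yint c + yintF cs

-- Enumeration of plane forests / trees.
-- forests f m : all lists of trees cs with edgesF cs = m (valid when f > m;
-- f is fuel).  First tree has k edges (k = 0..m-1) and weight k+1,
-- the rest has weight m-1-k.
forests : ℕ → ℕ → List (List Tree)
forests zero _ = []
forests (suc f) zero = [] ∷ []
forests (suc f) (suc n) =
  concatMap (λ k → concatMap (λ cs → map (λ rest → node cs ∷ rest) (forests f (n ∸ k)))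
                             (forests f k))
            (upTo (suc n))

𝒫 : ℕ → List Tree
𝒫 n = map node (forests (suc n) n)

monoT : Tree → List Var
monoT T' = replicate (oleaf T') X₁ ++ replicate (yleaf T') X₂
        ++ replicate (oint T') Y₁ ++ replicate (yint T') Y₂

G : ℕ → Poly Var
G zero = (1 , Y₂ ∷ []) ∷ []
G (suc n) = map (λ T' → (1 , monoT T')) (𝒫 (suc n))

{-# OPTIONS --safe #-}
module Submission where

-- Both sides are compared through their evaluations in an arbitrary commutative semiring, and
-- the evaluated identity is proved by induction on n simultaneously for all semirings.
-- Evaluating D p at ρ is reading off the ε-part of p evaluated in the dual numbers at
-- ρ + ε·(grammar ∘ ρ), so the case n over the dual numbers gives the case n + 1, once the
-- ε-part of G_n at those dual numbers is known.  That is computed with generating series: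
-- splitting a plane tree at the first child of its root shows that g = Σₙ Gₙ zⁿ (n ≥ 1)
-- solves g = z (x₁y₁ + (x₂ + y₂) g + g²); the ε-part of g solves the linearised equation,
-- whose unique solution is 2 t g (x₂ + y₂ + g + z g′), and comparing coefficients gives
-- D Gₙ = (n + 2) t Gₙ₊₁ − n t (x₂ + y₂) Gₙ.  Finally, evaluating at the variables of the
-- nested power series ℕ[[x₁, y₁, x₂, y₂, t]] recovers the coefficients of a polynomial.

open import Defs
open import Level using (0ℓ)
open import Algebra using (CommutativeSemiring; CommutativeMonoid)
import Algebra.Construct.DirectProduct as DirectProduct
import Algebra.Construct.Pointwise as Pointwise
open import Algebra.Structures.Biased using (isCommutativeSemiringˡ; isCommutativeMonoidˡ)
open import Data.Nat as ℕ using (ℕ; zero; suc; _!; _≡ᵇ_; _∸_; _<_; _≤_; z≤n; s≤s)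
import Data.Nat.Properties as ℕ
open import Data.Bool using (Bool; true; false; if_then_else_; _∧_)
open import Data.Bool.Properties using (∧-zeroʳ; ∧-identityʳ)
open import Data.List using (List; []; _∷_; _++_; map; concat; concatMap; applyUpTo; upTo; replicate)
open import Data.List.Properties using (map-cong-local)
open import Data.List.Relation.Unary.All.Properties using (applyUpTo⁺₁)
open import Data.Product using (_×_; _,_; proj₁; proj₂)
open import Data.Vec as Vec using (Vec; []; _∷_; _[_]%=_)
open import Data.Fin using (Fin; zero; suc)
open import Data.Maybe as Maybe using (Maybe; just; nothing; maybe′)
open import Data.Maybe.Properties using (maybe′-map)
open import Data.Product.Relation.Binary.Pointwise.NonDependent using (Pointwise; ×-isEquivalence)
open import Function using (_∘_; id)
open import Relation.Binary.PropositionalEquality as ≡ using (_≡_; cong; cong₂)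
import Algebra.Solver.Ring.NaturalCoefficients.Default as Solver
import Algebra.Properties.Semiring.Mult.TCOptimised as Mult
import Algebra.Properties.CommutativeSemiring.Exp as Exp
import Relation.Binary.Reasoning.Setoid as SetoidReasoning

CSemiring : Set₁
CSemiring = CommutativeSemiring 0ℓ 0ℓ

module SemiringReasoning (R : CSemiring) where
  open CommutativeSemiring R public
  open Exp R public using (_^_; ^-homo-*; ^-distrib-*)
  open Mult semiring public using (×1-homo-*) renaming (_×_ to _×ₙ_)
  open Solver R public using (solve; _:=_; _:+_; _:*_; con)
  open SetoidReasoning setoid public

  -- The optimised multiple: ⌜ n ⌝ is then definitionally the solver's constant con n.
  ⌜_⌝ : ℕ → Carrier
  ⌜ n ⌝ = n ×ₙ 1#

  ⌜⌝-suc : ∀ n → ⌜ suc n ⌝ ≈ 1# + ⌜ n ⌝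
  ⌜⌝-suc zero    = sym (+-identityʳ 1#)
  ⌜⌝-suc (suc n) = +-comm _ 1#

-- Dual numbers

Dual : CSemiring → CSemiring
Dual R = record
  { Carrier = Carrier × Carrier
  ; _≈_     = Pointwise _≈_ _≈_
  ; _+_     = λ (a , a′) (b , b′) → (a + b , a′ + b′)
  ; _*_     = λ (a , a′) (b , b′) → (a * b , a * b′ + a′ * b)
  ; 0#      = (0# , 0#)
  ; 1#      = (1# , 0#)
  ; isCommutativeSemiring = isCommutativeSemiringˡ record
    { +-isCommutativeMonoid = CommutativeMonoid.isCommutativeMonoid
        (DirectProduct.commutativeMonoid +-commutativeMonoid +-commutativeMonoid)
    ; *-isCommutativeMonoid = isCommutativeMonoidˡ record
      { isSemigroup = record
        { isMagma = record
          { isEquivalence = ×-isEquivalence isEquivalence isEquivalence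
          ; ∙-cong = λ (p , p′) (q , q′) → *-cong p q , +-cong (*-cong p q′) (*-cong p′ q)
          }
        ; assoc = λ (a , a′) (b , b′) (c , c′) → *-assoc a b c ,
            solve 6 (λ a a′ b b′ c c′ → a :* b :* c′ :+ (a :* b′ :+ a′ :* b) :* c
                                      := a :* (b :* c′ :+ b′ :* c) :+ a′ :* (b :* c))
                    refl a a′ b b′ c c′
        }
      ; identityˡ = λ (a , a′) → *-identityˡ a ,
          solve 2 (λ a a′ → con 1 :* a′ :+ con 0 :* a := a′) refl a a′
      ; comm = λ (a , a′) (b , b′) → *-comm a b ,
          solve 4 (λ a a′ b b′ → a :* b′ :+ a′ :* b := b :* a′ :+ b′ :* a) refl a a′ b b′
      }
    ; distribʳ = λ (a , a′) (b , b′) (c , c′) → distribʳ a b c ,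
        solve 6 (λ a a′ b b′ c c′ → (b :+ c) :* a′ :+ (b′ :+ c′) :* a
                                  := (b :* a′ :+ b′ :* a) :+ (c :* a′ :+ c′ :* a))
                refl a a′ b b′ c c′
    ; zeroˡ = λ (a , a′) → zeroˡ a ,
        solve 2 (λ a a′ → con 0 :* a′ :+ con 0 :* a := con 0) refl a a′
    }
  }
  where open SemiringReasoning R

module DualNumbers (R : CSemiring) where
  open SemiringReasoning R
  module D = SemiringReasoning (Dual R)

  proj₁-⌜⌝ : ∀ n → proj₁ D.⌜ n ⌝ ≈ ⌜ n ⌝
  proj₁-⌜⌝ zero          = refl
  proj₁-⌜⌝ (suc zero)    = refl
  proj₁-⌜⌝ (suc (suc n)) = +-cong (proj₁-⌜⌝ (suc n)) refl

  proj₂-⌜⌝ : ∀ n → proj₂ D.⌜ n ⌝ ≈ 0#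
  proj₂-⌜⌝ zero          = refl
  proj₂-⌜⌝ (suc zero)    = refl
  proj₂-⌜⌝ (suc (suc n)) = trans (+-identityʳ _) (proj₂-⌜⌝ (suc n))

  proj₁-^ : ∀ x n → proj₁ (x D.^ n) ≈ proj₁ x ^ n
  proj₁-^ x zero    = refl
  proj₁-^ x (suc n) = *-cong refl (proj₁-^ x n)

  proj₂-^ : ∀ x m → proj₂ (x D.^ suc m) ≈ ⌜ suc m ⌝ * (proj₁ x ^ m * proj₂ x)
  proj₂-^ (a , a′) zero    = solve 2 (λ a a′ → a :* con 0 :+ a′ :* con 1 := con 1 :* (con 1 :* a′)) refl a a′
  proj₂-^ (a , a′) (suc m) = begin
    a * proj₂ ((a , a′) D.^ suc m) + a′ * proj₁ ((a , a′) D.^ suc m)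
      ≈⟨ +-cong (*-cong refl (proj₂-^ (a , a′) m)) (*-cong refl (proj₁-^ (a , a′) (suc m))) ⟩
    a * (⌜ suc m ⌝ * (a ^ m * a′)) + a′ * (a * a ^ m)
      ≈⟨ solve 4 (λ a a′ N P → a :* (N :* (P :* a′)) :+ a′ :* (a :* P) := (con 1 :+ N) :* ((a :* P) :* a′))
               refl a a′ ⌜ suc m ⌝ (a ^ m) ⟩
    (1# + ⌜ suc m ⌝) * ((a * a ^ m) * a′)
      ≈⟨ *-cong (sym (⌜⌝-suc (suc m))) refl ⟩
    ⌜ suc (suc m) ⌝ * (a ^ suc m * a′) ∎

-- Power series

module PowerSeries (R : CSemiring) where
  open SemiringReasoning R

  Series : Set
  Series = ℕ → Carrier

  infix  4 _≋_
  infixl 6 _⊕_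
  infixl 7 _⊛_

  _≋_ : Series → Series → Set
  f ≋ g = ∀ n → f n ≈ g n

  _⊕_ : Series → Series → Series
  (f ⊕ g) n = f n + g n

  _⊛_ : Series → Series → Series
  (f ⊛ g) zero    = f 0 * g 0
  (f ⊛ g) (suc n) = f 0 * g (suc n) + (f ∘ suc ⊛ g) n

  const : Carrier → Series
  const r zero    = r
  const r (suc _) = 0#

  z : Series
  z zero          = 0#
  z (suc zero)    = 1#
  z (suc (suc _)) = 0#

  ⊛-cong : ∀ {f f′ g g′} → f ≋ f′ → g ≋ g′ → f ⊛ g ≋ f′ ⊛ g′
  ⊛-cong p q zero    = *-cong (p 0) (q 0)
  ⊛-cong p q (suc n) = +-cong (*-cong (p 0) (q (suc n))) (⊛-cong (p ∘ suc) q n)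

  0ₛ 1ₛ : Series
  0ₛ _ = 0#
  1ₛ   = const 1#

  ⊛-zeroˡ : ∀ g → 0ₛ ⊛ g ≋ 0ₛ
  ⊛-zeroˡ g zero    = zeroˡ _
  ⊛-zeroˡ g (suc n) = trans (+-cong (zeroˡ _) (⊛-zeroˡ g n)) (+-identityˡ _)

  const-⊛ : ∀ r g n → (const r ⊛ g) n ≈ r * g n
  const-⊛ r g zero    = refl
  const-⊛ r g (suc n) = trans (+-cong refl (⊛-zeroˡ g n)) (+-identityʳ _)

  ⊛-identityˡ : ∀ g → 1ₛ ⊛ g ≋ g
  ⊛-identityˡ g n = trans (const-⊛ 1# g n) (*-identityˡ _)

  z-⊛-zero : ∀ g → (z ⊛ g) 0 ≈ 0#
  z-⊛-zero g = zeroˡ _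

  z-⊛-suc : ∀ g n → (z ⊛ g) (suc n) ≈ g n
  z-⊛-suc g n = trans (+-cong (zeroˡ _) (⊛-identityˡ′ n)) (+-identityˡ _)
    where
    ⊛-identityˡ′ : ∀ n → (z ∘ suc ⊛ g) n ≈ g n
    ⊛-identityˡ′ n = trans (⊛-cong {f′ = 1ₛ} (λ { zero → refl ; (suc _) → refl }) (λ _ → refl) n)
                           (⊛-identityˡ g n)

  ⊛-distribʳ : ∀ f g h → (f ⊕ g) ⊛ h ≋ f ⊛ h ⊕ g ⊛ h
  ⊛-distribʳ f g h zero    = distribʳ _ _ _
  ⊛-distribʳ f g h (suc n) = trans (+-cong (distribʳ _ _ _) (⊛-distribʳ _ _ h n))
    (solve 4 (λ a b c d → (a :+ b) :+ (c :+ d) := (a :+ c) :+ (b :+ d)) refl _ _ _ _)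

  ⊛-scaleˡ : ∀ c f g → (λ k → c * f k) ⊛ g ≋ (λ n → c * (f ⊛ g) n)
  ⊛-scaleˡ c f g zero    = *-assoc _ _ _
  ⊛-scaleˡ c f g (suc n) = trans (+-cong (*-assoc _ _ _) (⊛-scaleˡ c _ g n)) (sym (distribˡ _ _ _))

  ⊛-comm : ∀ f g → f ⊛ g ≋ g ⊛ f
  ⊛-comm f g zero          = *-comm _ _
  ⊛-comm f g (suc zero)    = solve 4 (λ a b c d → a :* b :+ c :* d := d :* c :+ b :* a) refl _ _ _ _
  ⊛-comm f g (suc (suc m)) = begin
    f 0 * g (suc (suc m)) + (f′ ⊛ g) (suc m)                ≈⟨ +-cong refl (⊛-comm f′ g (suc m)) ⟩
    f 0 * g (suc (suc m)) + (g 0 * f (suc (suc m)) + (g′ ⊛ f′) m)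
                                                             ≈⟨ +-cong refl (+-cong refl (⊛-comm g′ f′ m)) ⟩
    f 0 * g (suc (suc m)) + (g 0 * f (suc (suc m)) + (f′ ⊛ g′) m)
                                                             ≈⟨ solve 3 (λ a b c → a :+ (b :+ c) := b :+ (a :+ c)) refl _ _ _ ⟩
    g 0 * f (suc (suc m)) + (f 0 * g (suc (suc m)) + (f′ ⊛ g′) m)
                                                             ≈⟨ +-cong refl (⊛-comm f g′ (suc m)) ⟩
    g 0 * f (suc (suc m)) + (g′ ⊛ f) (suc m)                ∎
    where f′ = f ∘ suc
          g′ = g ∘ suc

  ⊛-assoc : ∀ f g h → (f ⊛ g) ⊛ h ≋ f ⊛ (g ⊛ h)
  ⊛-assoc f g h zero    = *-assoc _ _ _
  ⊛-assoc f g h (suc n) = begin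
    (f 0 * g 0) * h (suc n) + ((f ⊛ g) ∘ suc ⊛ h) n
      ≈⟨ +-cong refl (⊛-distribʳ (λ k → f 0 * g (suc k)) (f′ ⊛ g) h n) ⟩
    (f 0 * g 0) * h (suc n) + (((λ k → f 0 * g′ k) ⊛ h) n + (f′ ⊛ g ⊛ h) n)
      ≈⟨ +-cong refl (+-cong (⊛-scaleˡ (f 0) g′ h n) (⊛-assoc f′ g h n)) ⟩
    (f 0 * g 0) * h (suc n) + (f 0 * (g′ ⊛ h) n + (f′ ⊛ (g ⊛ h)) n)
      ≈⟨ solve 5 (λ a b c d e → (a :* b) :* c :+ (a :* d :+ e) := a :* (b :* c :+ d) :+ e) refl _ _ _ _ _ ⟩
    f 0 * (g 0 * h (suc n) + (g′ ⊛ h) n) + (f′ ⊛ (g ⊛ h)) n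
      ∎
    where f′ = f ∘ suc
          g′ = g ∘ suc
  const-+ : ∀ r s → const (r + s) ≋ const r ⊕ const s
  const-+ r s zero    = refl
  const-+ r s (suc n) = sym (+-identityˡ _)

  const-* : ∀ r s → const (r * s) ≋ const r ⊛ const s
  const-* r s zero    = refl
  const-* r s (suc n) = sym (trans (const-⊛ r (const s) (suc n)) (zeroʳ _))

  θ : Series → Series
  θ f n = ⌜ n ⌝ * f n

  θ-cong : ∀ {f g} → f ≋ g → θ f ≋ θ g
  θ-cong p n = *-cong refl (p n)

  θ-⊕ : ∀ f g → θ (f ⊕ g) ≋ θ f ⊕ θ g
  θ-⊕ f g n = distribˡ _ _ _

  θ-const : ∀ r → θ (const r) ≋ 0ₛ
  θ-const r zero    = zeroˡ _
  θ-const r (suc n) = zeroʳ _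

  θ-z : θ z ≋ z
  θ-z zero          = zeroˡ _
  θ-z (suc zero)    = *-identityʳ _
  θ-z (suc (suc n)) = zeroʳ _

  θ-⊛ : ∀ f g → θ (f ⊛ g) ≋ θ f ⊛ g ⊕ f ⊛ θ g
  θ-⊛ f g zero    = solve 2 (λ a b → con 0 :* (a :* b) := con 0 :* a :* b :+ a :* (con 0 :* b)) refl _ _
  θ-⊛ f g (suc n) = sym (begin
    (0# * f 0 * g (suc n) + (θ f ∘ suc ⊛ g) n) + (f 0 * (M * g (suc n)) + (f′ ⊛ θ g) n)
      ≈⟨ +-cong (+-cong refl (trans (⊛-cong θf∘suc (λ _ → refl) n) (⊛-distribʳ f′ (θ f′) g n))) refl ⟩
    (0# * f 0 * g (suc n) + ((f′ ⊛ g) n + (θ f′ ⊛ g) n)) + (f 0 * (M * g (suc n)) + (f′ ⊛ θ g) n)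
      ≈⟨ solve 7 (λ a b c d e M N → (con 0 :* a :* b :+ (c :+ d)) :+ (a :* (M :* b) :+ e)
                                   := M :* (a :* b) :+ c :+ (d :+ e)) refl _ _ _ _ _ M ⌜ n ⌝ ⟩
    M * (f 0 * g (suc n)) + (f′ ⊛ g) n + ((θ f′ ⊛ g) n + (f′ ⊛ θ g) n)
      ≈⟨ +-cong refl (sym (θ-⊛ f′ g n)) ⟩
    M * (f 0 * g (suc n)) + (f′ ⊛ g) n + ⌜ n ⌝ * (f′ ⊛ g) n
      ≈⟨ +-cong (+-cong refl (sym (*-identityˡ _))) refl ⟩
    M * (f 0 * g (suc n)) + 1# * (f′ ⊛ g) n + ⌜ n ⌝ * (f′ ⊛ g) n
      ≈⟨ trans (+-assoc _ _ _) (+-cong refl (sym (distribʳ _ _ _))) ⟩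
    M * (f 0 * g (suc n)) + (1# + ⌜ n ⌝) * (f′ ⊛ g) n
      ≈⟨ +-cong refl (*-cong (sym (⌜⌝-suc n)) refl) ⟩
    M * (f 0 * g (suc n)) + M * (f′ ⊛ g) n
      ≈⟨ sym (distribˡ _ _ _) ⟩
    M * (f 0 * g (suc n) + (f′ ⊛ g) n) ∎)
    where
    f′ = f ∘ suc
    M  = ⌜ suc n ⌝
    θf∘suc : θ f ∘ suc ≋ f′ ⊕ θ f′
    θf∘suc k = trans (*-cong (⌜⌝-suc k) refl) (trans (distribʳ _ _ _) (+-cong (*-identityˡ _) refl))

  AgreeUpTo : ℕ → Series → Series → Set
  AgreeUpTo n f g = ∀ k → k ≤ n → f k ≈ g k

  Causal : (Series → Series) → Set
  Causal F = ∀ n f g → AgreeUpTo n f g → F f n ≈ F g n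

  ⊛-causalʳ : ∀ f {g g′} n → AgreeUpTo n g g′ → (f ⊛ g) n ≈ (f ⊛ g′) n
  ⊛-causalʳ f zero    g≈g′ = *-cong refl (g≈g′ 0 z≤n)
  ⊛-causalʳ f (suc n) g≈g′ = +-cong (*-cong refl (g≈g′ (suc n) ℕ.≤-refl))
    (⊛-causalʳ (f ∘ suc) n (λ k k≤n → g≈g′ k (ℕ.m≤n⇒m≤1+n k≤n)))

  ⊛-causalˡ : ∀ {f f′} g n → AgreeUpTo n f f′ → (f ⊛ g) n ≈ (f′ ⊛ g) n
  ⊛-causalˡ g n f≈f′ = trans (⊛-comm _ g n) (trans (⊛-causalʳ g n f≈f′) (⊛-comm g _ n))

  fixpoint-unique : ∀ F → Causal F → ∀ {f g} → f ≋ z ⊛ F f → g ≋ z ⊛ F g → f ≋ g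
  fixpoint-unique F causal {f} {g} f-eq g-eq n = agree n n ℕ.≤-refl
    where
    agree : ∀ n → AgreeUpTo n f g
    agree n zero _ = trans (f-eq 0) (trans (z-⊛-zero (F f)) (sym (trans (g-eq 0) (z-⊛-zero (F g)))))
    agree (suc n) (suc k) (s≤s k≤n) = begin
      f (suc k)        ≈⟨ trans (f-eq (suc k)) (z-⊛-suc (F f) k) ⟩
      F f k            ≈⟨ causal k f g (λ j j≤k → agree n j (ℕ.≤-trans j≤k k≤n)) ⟩
      F g k            ≈⟨ sym (trans (g-eq (suc k)) (z-⊛-suc (F g) k)) ⟩
      g (suc k)        ∎


PS : CSemiring → CSemiring
PS R = record
  { Carrier = Series
  ; _≈_     = _≋_
  ; _+_     = _⊕_
  ; _*_     = _⊛_
  ; 0#      = 0ₛ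
  ; 1#      = 1ₛ
  ; isCommutativeSemiring = isCommutativeSemiringˡ record
    { +-isCommutativeMonoid = Pointwise.isCommutativeMonoid ℕ +-isCommutativeMonoid
    ; *-isCommutativeMonoid = isCommutativeMonoidˡ record
      { isSemigroup = record
        { isMagma = record
          { isEquivalence = Pointwise.isEquivalence ℕ isEquivalence
          ; ∙-cong        = ⊛-cong
          }
        ; assoc = ⊛-assoc
        }
      ; identityˡ = ⊛-identityˡ
      ; comm      = ⊛-comm
      }
    ; distribʳ = λ h f g → ⊛-distribʳ f g h
    ; zeroˡ    = ⊛-zeroˡ
    }
  }
  where open SemiringReasoning R
        open PowerSeries R

module ConstSeries (R : CSemiring) where
  open SemiringReasoning R
  open PowerSeries R
  private module ℙ = SemiringReasoning (PS R)

  const-cong : ∀ {r s} → r ≈ s → const r ≋ const s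
  const-cong r≈s zero    = r≈s
  const-cong r≈s (suc _) = refl

  const-⌜⌝ : ∀ n → const ⌜ n ⌝ ≋ ℙ.⌜ n ⌝
  const-⌜⌝ zero          zero    = refl
  const-⌜⌝ zero          (suc _) = refl
  const-⌜⌝ (suc zero)    _       = refl
  const-⌜⌝ (suc (suc n)) k       = trans (const-+ ⌜ suc n ⌝ 1# k) (+-cong (const-⌜⌝ (suc n) k) refl)

  const-⌜⌝* : ∀ n r → const (⌜ n ⌝ * r) ≋ ℙ.⌜ n ⌝ ⊛ const r
  const-⌜⌝* n r = ℙ.trans (const-* ⌜ n ⌝ r) (ℙ.*-cong (const-⌜⌝ n) ℙ.refl)

-- Evaluation of polynomials

module Evaluation (R : CSemiring) {V : Set} (ρ : V → CommutativeSemiring.Carrier R) where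
  open SemiringReasoning R

  evalWord : List V → Carrier
  evalWord []      = 1#
  evalWord (v ∷ u) = ρ v * evalWord u

  eval : Poly V → Carrier
  eval []            = 0#
  eval ((c , u) ∷ p) = ⌜ c ⌝ * evalWord u + eval p

  eval-++ : ∀ p q → eval (p ++ q) ≈ eval p + eval q
  eval-++ []            q = sym (+-identityˡ _)
  eval-++ ((c , u) ∷ p) q = trans (+-cong refl (eval-++ p q)) (sym (+-assoc _ _ _))

  evalWord-++ : ∀ u v → evalWord (u ++ v) ≈ evalWord u * evalWord v
  evalWord-++ []      v = sym (*-identityˡ _)
  evalWord-++ (x ∷ u) v = trans (*-cong refl (evalWord-++ u v)) (sym (*-assoc _ _ _))

  eval-monomial : ∀ u → eval ((1 , u) ∷ []) ≈ evalWord u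
  eval-monomial u = trans (+-identityʳ _) (*-identityˡ _)

  -- mulP multiplies by a term through an anonymous function of Defs, so it is
  -- abstracted here as any f that acts on terms as that function does.
  private
    eval-mulTerm : ∀ a u (f : ℕ × List V → ℕ × List V) → (∀ b v → f (b , v) ≡ (a ℕ.* b , u ++ v)) →
                   ∀ q → eval (map f q) ≈ (⌜ a ⌝ * evalWord u) * eval q
    eval-mulTerm a u f f-def []            = sym (zeroʳ _)
    eval-mulTerm a u f f-def ((b , v) ∷ q) rewrite f-def b v =
      trans (+-cong (*-cong (×1-homo-* a b) (evalWord-++ u v)) (eval-mulTerm a u f f-def q))
        (solve 5 (λ A B U V Q → (A :* B) :* (U :* V) :+ (A :* U) :* Q := (A :* U) :* (B :* V :+ Q))
               refl _ _ _ _ _)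

  eval-mulP : ∀ p q → eval (mulP p q) ≈ eval p * eval q
  eval-mulP []            q = sym (zeroˡ _)
  eval-mulP ((a , u) ∷ p) q =
    trans (eval-++ (map _ q) (mulP p q))
      (trans (+-cong (eval-mulTerm a u _ (λ _ _ → ≡.refl) q) (eval-mulP p q)) (sym (distribʳ _ _ _)))

  eval-scaleP : ∀ c p → eval (scaleP c p) ≈ ⌜ c ⌝ * eval p
  eval-scaleP c []            = sym (zeroʳ _)
  eval-scaleP c ((a , u) ∷ p) =
    trans (+-cong (trans (*-cong (×1-homo-* c a) refl) (*-assoc _ _ _)) (eval-scaleP c p)) (sym (distribˡ _ _ _))

module Derivation (R : CSemiring) {V : Set} (f : V → Poly V) (ρ : V → CommutativeSemiring.Carrier R) where
  open SemiringReasoning R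
  open Evaluation R ρ
  open DualNumbers R

  ρ̃ : V → Carrier × Carrier
  ρ̃ v = (ρ v , eval (f v))

  module Ẽ = Evaluation (Dual R) ρ̃

  proj₁-evalWord : ∀ u → proj₁ (Ẽ.evalWord u) ≈ evalWord u
  proj₁-evalWord []      = refl
  proj₁-evalWord (v ∷ u) = *-cong refl (proj₁-evalWord u)

  eval-derWord : ∀ u → eval (derWord f u) ≈ proj₂ (Ẽ.evalWord u)
  eval-derWord []       = refl
  eval-derWord (v ∷ ws) = begin
    eval (mulP (f v) ((1 , ws) ∷ []) ++ mulP ((1 , v ∷ []) ∷ []) (derWord f ws))
      ≈⟨ eval-++ (mulP (f v) _) (mulP ((1 , v ∷ []) ∷ []) (derWord f ws)) ⟩
    eval (mulP (f v) ((1 , ws) ∷ [])) + eval (mulP ((1 , v ∷ []) ∷ []) (derWord f ws))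
      ≈⟨ +-cong (eval-mulP (f v) _) (eval-mulP ((1 , v ∷ []) ∷ []) (derWord f ws)) ⟩
    eval (f v) * eval ((1 , ws) ∷ []) + eval ((1 , v ∷ []) ∷ []) * eval (derWord f ws)
      ≈⟨ +-cong (*-cong refl (trans (eval-monomial ws) (sym (proj₁-evalWord ws))))
                (*-cong (trans (eval-monomial (v ∷ [])) (*-identityʳ _)) (eval-derWord ws)) ⟩
    eval (f v) * proj₁ (Ẽ.evalWord ws) + ρ v * proj₂ (Ẽ.evalWord ws)
      ≈⟨ +-comm _ _ ⟩
    ρ v * proj₂ (Ẽ.evalWord ws) + eval (f v) * proj₁ (Ẽ.evalWord ws) ∎

  eval-derP : ∀ p → eval (derP f p) ≈ proj₂ (Ẽ.eval p)
  eval-derP []            = refl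
  eval-derP ((c , u) ∷ p) = trans (eval-++ (scaleP c (derWord f u)) (derP f p)) (+-cong eval-derTerm (eval-derP p))
    where
    eval-derTerm : eval (scaleP c (derWord f u)) ≈ proj₂ (D.⌜ c ⌝ D.* Ẽ.evalWord u)
    eval-derTerm = begin
      eval (scaleP c (derWord f u))                          ≈⟨ eval-scaleP c (derWord f u) ⟩
      ⌜ c ⌝ * eval (derWord f u)                             ≈⟨ *-cong (sym (proj₁-⌜⌝ c)) (eval-derWord u) ⟩
      proj₁ D.⌜ c ⌝ * proj₂ (Ẽ.evalWord u)                    ≈⟨ +-identityʳ _ ⟨
      proj₁ D.⌜ c ⌝ * proj₂ (Ẽ.evalWord u) + 0#
        ≈⟨ +-cong refl (trans (*-cong (proj₂-⌜⌝ c) refl) (zeroˡ _)) ⟨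
      proj₁ D.⌜ c ⌝ * proj₂ (Ẽ.evalWord u) + proj₂ D.⌜ c ⌝ * proj₁ (Ẽ.evalWord u) ∎

-- Generating series of plane trees

module Sums (R : CSemiring) where
  open SemiringReasoning R
  open PowerSeries R

  sumList : {A : Set} → (A → Carrier) → List A → Carrier
  sumList φ []       = 0#
  sumList φ (x ∷ xs) = φ x + sumList φ xs

  syntax sumList (λ x → e) xs = ∑[ x ∈ xs ] e

  sumBelow : ℕ → (ℕ → Carrier) → Carrier
  sumBelow zero    F = 0#
  sumBelow (suc m) F = F 0 + sumBelow m (F ∘ suc)

  syntax sumBelow m (λ k → e) = ∑[ k < m ] e

  sumList-cong : ∀ {A : Set} {φ ψ : A → Carrier} → (∀ x → φ x ≈ ψ x) → ∀ xs → sumList φ xs ≈ sumList ψ xs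
  sumList-cong φ≈ψ []       = refl
  sumList-cong φ≈ψ (x ∷ xs) = +-cong (φ≈ψ x) (sumList-cong φ≈ψ xs)

  sumBelow-cong : ∀ m {F G : ℕ → Carrier} → (∀ k → k < m → F k ≈ G k) → sumBelow m F ≈ sumBelow m G
  sumBelow-cong zero    F≈G = refl
  sumBelow-cong (suc m) F≈G = +-cong (F≈G 0 (s≤s z≤n)) (sumBelow-cong m (λ k k<m → F≈G (suc k) (s≤s k<m)))

  sumList-zero : ∀ {A : Set} (xs : List A) → ∑[ x ∈ xs ] 0# ≈ 0#
  sumList-zero []       = refl
  sumList-zero (x ∷ xs) = trans (+-identityˡ _) (sumList-zero xs)

  sumList-++ : ∀ {A : Set} (φ : A → Carrier) xs ys → sumList φ (xs ++ ys) ≈ sumList φ xs + sumList φ ys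
  sumList-++ φ []       ys = sym (+-identityˡ _)
  sumList-++ φ (x ∷ xs) ys = trans (+-cong refl (sumList-++ φ xs ys)) (sym (+-assoc _ _ _))

  sumList-concatMap : ∀ {A B : Set} (φ : B → Carrier) (g : A → List B) xs →
                      sumList φ (concatMap g xs) ≈ ∑[ x ∈ xs ] sumList φ (g x)
  sumList-concatMap φ g []       = refl
  sumList-concatMap φ g (x ∷ xs) = trans (sumList-++ φ (g x) (concatMap g xs)) (+-cong refl (sumList-concatMap φ g xs))

  sumList-map : ∀ {A B : Set} (φ : B → Carrier) (g : A → B) xs → sumList φ (map g xs) ≡ sumList (φ ∘ g) xs
  sumList-map φ g []       = ≡.refl
  sumList-map φ g (x ∷ xs) = cong (φ (g x) +_) (sumList-map φ g xs)

  sumList-applyUpTo : ∀ (F : ℕ → Carrier) h m → sumList F (applyUpTo h m) ≡ sumBelow m (F ∘ h)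
  sumList-applyUpTo F h zero    = ≡.refl
  sumList-applyUpTo F h (suc m) = cong (F (h 0) +_) (sumList-applyUpTo F (h ∘ suc) m)

  sumList-*ˡ : ∀ {A : Set} c (φ : A → Carrier) xs → ∑[ x ∈ xs ] (c * φ x) ≈ c * sumList φ xs
  sumList-*ˡ c φ []       = sym (zeroʳ _)
  sumList-*ˡ c φ (x ∷ xs) = trans (+-cong refl (sumList-*ˡ c φ xs)) (sym (distribˡ _ _ _))

  sumList-*ʳ : ∀ {A : Set} c (φ : A → Carrier) xs → ∑[ x ∈ xs ] (φ x * c) ≈ sumList φ xs * c
  sumList-*ʳ c φ []       = sym (zeroˡ _)
  sumList-*ʳ c φ (x ∷ xs) = trans (+-cong refl (sumList-*ʳ c φ xs)) (sym (distribʳ _ _ _))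

  sumList-+ : ∀ {A : Set} (φ ψ : A → Carrier) xs → ∑[ x ∈ xs ] (φ x + ψ x) ≈ sumList φ xs + sumList ψ xs
  sumList-+ φ ψ []       = sym (+-identityˡ _)
  sumList-+ φ ψ (x ∷ xs) = trans (+-cong refl (sumList-+ φ ψ xs))
    (solve 4 (λ a b c d → (a :+ b) :+ (c :+ d) := (a :+ c) :+ (b :+ d)) refl _ _ _ _)

  ⊛-sumBelow : ∀ f g n → (f ⊛ g) n ≈ ∑[ k < suc n ] (f k * g (n ∸ k))
  ⊛-sumBelow f g zero    = sym (+-identityʳ _)
  ⊛-sumBelow f g (suc n) = +-cong refl (⊛-sumBelow (f ∘ suc) g n)

forests-fuel : ∀ {f f′} k → k < f → k < f′ → forests f k ≡ forests f′ k
forests-fuel {suc f} {suc f′} zero    _         _          = ≡.refl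
forests-fuel {suc f} {suc f′} (suc n) (s≤s n<f) (s≤s n<f′) =
  cong concat (map-cong-local (applyUpTo⁺₁ id (suc n) λ { {k} (s≤s k≤n) →
    cong₂ (λ firsts rests → concatMap (λ cs → map (λ rest → node cs ∷ rest) rests) firsts)
      (forests-fuel k (ℕ.≤-<-trans k≤n n<f) (ℕ.≤-<-trans k≤n n<f′))
      (forests-fuel (n ∸ k) (ℕ.≤-<-trans (ℕ.m∸n≤m n k) n<f) (ℕ.≤-<-trans (ℕ.m∸n≤m n k) n<f′)) }))

module ForestSeries (R : CSemiring) where
  open SemiringReasoning R
  open PowerSeries R
  open Sums R

  forestSeries : (List Tree → Carrier) → Series
  forestSeries φ k = sumList φ (forests (suc k) k)

  private
    sum-forests-suc : ∀ f n (φ : List Tree → Carrier) →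
      sumList φ (forests (suc f) (suc n)) ≈
      ∑[ k < suc n ] ∑[ cs ∈ forests f k ] ∑[ rest ∈ forests f (n ∸ k) ] φ (node cs ∷ rest)
    sum-forests-suc f n φ = begin
      sumList φ (forests (suc f) (suc n))
        ≈⟨ sumList-concatMap φ splitAt (upTo (suc n)) ⟩
      ∑[ k ∈ upTo (suc n) ] sumList φ (splitAt k)
        ≈⟨ sumList-cong (λ k → trans (sumList-concatMap φ (rests k) (forests f k))
                                 (sumList-cong (λ cs → reflexive (sumList-map φ (node cs ∷_) (forests f (n ∸ k))))
                                               (forests f k)))
                        (upTo (suc n)) ⟩
      ∑[ k ∈ upTo (suc n) ] ∑[ cs ∈ forests f k ] ∑[ rest ∈ forests f (n ∸ k) ] φ (node cs ∷ rest)
        ≡⟨ sumList-applyUpTo _ id (suc n) ⟩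
      ∑[ k < suc n ] ∑[ cs ∈ forests f k ] ∑[ rest ∈ forests f (n ∸ k) ] φ (node cs ∷ rest) ∎
      where
      rests : ℕ → List Tree → List (List Tree)
      rests k cs = map (node cs ∷_) (forests f (n ∸ k))
      splitAt : ℕ → List (List Tree)
      splitAt k = concatMap (rests k) (forests f k)

  forestSeries-cong : ∀ {φ ψ} → (∀ c cs → φ (c ∷ cs) ≈ ψ (c ∷ cs)) → ∀ n →
                      forestSeries φ (suc n) ≈ forestSeries ψ (suc n)
  forestSeries-cong {φ} {ψ} φ≈ψ n = begin
    forestSeries φ (suc n)
      ≈⟨ sum-forests-suc (suc n) n φ ⟩
    ∑[ k < suc n ] ∑[ cs ∈ forests (suc n) k ] ∑[ rest ∈ forests (suc n) (n ∸ k) ] φ (node cs ∷ rest)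
      ≈⟨ sumBelow-cong (suc n) (λ k _ → sumList-cong (λ cs → sumList-cong (φ≈ψ (node cs)) (forests (suc n) (n ∸ k)))
                                                     (forests (suc n) k)) ⟩
    ∑[ k < suc n ] ∑[ cs ∈ forests (suc n) k ] ∑[ rest ∈ forests (suc n) (n ∸ k) ] ψ (node cs ∷ rest)
      ≈⟨ sum-forests-suc (suc n) n ψ ⟨
    forestSeries ψ (suc n) ∎

  forestSeries-⊛ : ∀ {φ} α β → (∀ cs rest → φ (node cs ∷ rest) ≈ α cs * β rest) →
                   ∀ n → forestSeries φ (suc n) ≈ (forestSeries α ⊛ forestSeries β) n
  forestSeries-⊛ {φ} α β φ≈α*β n = begin
    forestSeries φ (suc n)
      ≈⟨ sum-forests-suc (suc n) n φ ⟩
    ∑[ k < suc n ] ∑[ cs ∈ forests (suc n) k ] ∑[ rest ∈ forests (suc n) (n ∸ k) ] φ (node cs ∷ rest)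
      ≈⟨ sumBelow-cong (suc n) (λ k k<1+n → factor k (s≤s (ℕ.m∸n≤m n k)) k<1+n) ⟩
    ∑[ k < suc n ] (forestSeries α k * forestSeries β (n ∸ k))
      ≈⟨ ⊛-sumBelow _ _ n ⟨
    (forestSeries α ⊛ forestSeries β) n ∎
    where
    factor : ∀ k → n ∸ k < suc n → k < suc n →
      ∑[ cs ∈ forests (suc n) k ] ∑[ rest ∈ forests (suc n) (n ∸ k) ] φ (node cs ∷ rest)
        ≈ forestSeries α k * forestSeries β (n ∸ k)
    factor k n∸k<1+n k<1+n = begin
      ∑[ cs ∈ forests (suc n) k ] ∑[ rest ∈ forests (suc n) (n ∸ k) ] φ (node cs ∷ rest)
        ≈⟨ sumList-cong (λ cs → trans (sumList-cong (φ≈α*β cs) rests) (sumList-*ˡ (α cs) β rests)) firsts ⟩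
      ∑[ cs ∈ forests (suc n) k ] (α cs * sumList β (forests (suc n) (n ∸ k)))
        ≈⟨ sumList-*ʳ _ α firsts ⟩
      sumList α (forests (suc n) k) * sumList β (forests (suc n) (n ∸ k))
        ≡⟨ cong₂ (λ A B → sumList α A * sumList β B)
                 (forests-fuel k k<1+n ℕ.≤-refl) (forests-fuel (n ∸ k) n∸k<1+n ℕ.≤-refl) ⟩
      forestSeries α k * forestSeries β (n ∸ k) ∎
      where firsts = forests (suc n) k
            rests  = forests (suc n) (n ∸ k)

  ifEmpty : Carrier → List Tree → Carrier
  ifEmpty r []      = r
  ifEmpty r (_ ∷ _) = 0#

  forestSeries-ifEmpty : ∀ r → forestSeries (ifEmpty r) ≋ const r
  forestSeries-ifEmpty r zero    = +-identityʳ r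
  forestSeries-ifEmpty r (suc n) =
    trans (forestSeries-cong {ψ = λ _ → 0#} (λ _ _ → refl) n) (sumList-zero (forests (suc (suc n)) (suc n)))

module TreeSeries (R : CSemiring) (w x y : CommutativeSemiring.Carrier R) where
  open SemiringReasoning R
  open PowerSeries R
  open Sums R
  open ForestSeries R

  weight : Tree → Carrier
  weight τ = w ^ oleaf τ * (x ^ yleaf τ * y ^ yint τ)

  forestWeight : List Tree → Carrier
  forestWeight cs = w ^ oleafF cs * (x ^ yleafF cs * y ^ yintF cs)

  siblingsWeight : List Tree → Carrier
  siblingsWeight cs = x ^ leafCount cs * forestWeight cs

  weight⁺ : List Tree → Carrier
  weight⁺ []       = 0#
  weight⁺ (c ∷ cs) = weight (node (c ∷ cs))

  firstChildFactor : Tree → Carrier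
  firstChildFactor c = if isLeaf c then w else y

  forestWeight-∷ : ∀ c cs → forestWeight (c ∷ cs) ≈ weight c * forestWeight cs
  forestWeight-∷ c cs =
    trans (*-cong (^-homo-* w (oleaf c) _) (*-cong (^-homo-* x (yleaf c) _) (^-homo-* y (yint c) _)))
      (solve 6 (λ a b c d e f → (a :* b) :* ((c :* d) :* (e :* f)) := (a :* (c :* e)) :* (b :* (d :* f)))
             refl _ _ _ _ _ _)

  private
    firstChildFactor-^ : ∀ b → w ^ ind b * y ^ (1 ∸ ind b) ≈ (if b then w else y)
    firstChildFactor-^ true  = trans (*-identityʳ _) (*-identityʳ _)
    firstChildFactor-^ false = trans (*-identityˡ _) (*-identityʳ _)

  weight-node-∷ : ∀ c cs → weight (node (c ∷ cs)) ≈ (firstChildFactor c * weight c) * siblingsWeight cs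
  weight-node-∷ c cs = begin
    weight (node (c ∷ cs))
      ≈⟨ *-cong (^-homo-* w (ind (isLeaf c)) _) (*-cong (^-homo-* x (leafCount cs) _) (^-homo-* y (1 ∸ ind (isLeaf c)) _)) ⟩
    (w ^ ind (isLeaf c) * w ^ oleafF (c ∷ cs)) *
      ((x ^ leafCount cs * x ^ yleafF (c ∷ cs)) * (y ^ (1 ∸ ind (isLeaf c)) * y ^ yintF (c ∷ cs)))
      ≈⟨ solve 6 (λ a b c d e f → (a :* b) :* ((c :* d) :* (e :* f)) := (a :* e) :* (c :* (b :* (d :* f))))
               refl _ _ _ _ _ _ ⟩
    (w ^ ind (isLeaf c) * y ^ (1 ∸ ind (isLeaf c))) * (x ^ leafCount cs * forestWeight (c ∷ cs))
      ≈⟨ *-cong (firstChildFactor-^ (isLeaf c)) (*-cong refl (forestWeight-∷ c cs)) ⟩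
    firstChildFactor c * (x ^ leafCount cs * (weight c * forestWeight cs))
      ≈⟨ solve 4 (λ a b c d → a :* (b :* (c :* d)) := (a :* c) :* (b :* d)) refl _ _ _ _ ⟩
    (firstChildFactor c * weight c) * siblingsWeight cs ∎

  siblingsWeight-∷ : ∀ c cs → siblingsWeight (c ∷ cs) ≈ (x ^ ind (isLeaf c) * weight c) * siblingsWeight cs
  siblingsWeight-∷ c cs = trans (*-cong (^-homo-* x (ind (isLeaf c)) _) (forestWeight-∷ c cs))
    (solve 4 (λ a b c d → (a :* b) :* (c :* d) := (a :* c) :* (b :* d)) refl _ _ _ _)

  weight-leaf : weight (node []) ≈ 1#
  weight-leaf = trans (*-identityˡ _) (*-identityˡ _)

  firstChild-node : ∀ l → firstChildFactor (node l) * weight (node l) ≈ ifEmpty w l + y * weight⁺ l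
  firstChild-node []      = trans (*-cong refl weight-leaf)
                              (trans (*-identityʳ _) (sym (trans (+-cong refl (zeroʳ _)) (+-identityʳ _))))
  firstChild-node (_ ∷ _) = sym (+-identityˡ _)

  youngerSibling-node : ∀ l → x ^ ind (isLeaf (node l)) * weight (node l) ≈ ifEmpty x l + weight⁺ l
  youngerSibling-node []      = trans (*-cong (*-identityʳ _) weight-leaf) (trans (*-identityʳ _) (sym (+-identityʳ _)))
  youngerSibling-node (_ ∷ _) = trans (*-identityˡ _) (sym (+-identityˡ _))

  treeSeries siblingSeries : Series
  treeSeries    = forestSeries weight⁺
  siblingSeries = forestSeries siblingsWeight

  -- Split a tree at the first child of its root: a leaf there is old and makes its parent oint
  -- (weight w = x₁y₁), otherwise the parent is yint (weight y); leaves among the younger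
  -- siblings are young (weight x each).
  treeSeries-decomposition : treeSeries ≋ z ⊛ ((const w ⊕ const y ⊛ treeSeries) ⊛ siblingSeries)
  treeSeries-decomposition zero    = trans (+-identityʳ _) (sym (z-⊛-zero ((const w ⊕ const y ⊛ treeSeries) ⊛ siblingSeries)))
  treeSeries-decomposition (suc n) = begin
    treeSeries (suc n)
      ≈⟨ forestSeries-⊛ (λ cs → ifEmpty w cs + y * weight⁺ cs) siblingsWeight
           (λ cs rest → trans (weight-node-∷ (node cs) rest) (*-cong (firstChild-node cs) refl)) n ⟩
    (forestSeries (λ cs → ifEmpty w cs + y * weight⁺ cs) ⊛ siblingSeries) n
      ≈⟨ ⊛-cong firstChildSeries (λ _ → refl) n ⟩
    ((const w ⊕ const y ⊛ treeSeries) ⊛ siblingSeries) n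
      ≈⟨ z-⊛-suc _ n ⟨
    (z ⊛ ((const w ⊕ const y ⊛ treeSeries) ⊛ siblingSeries)) (suc n) ∎
    where
    firstChildSeries : forestSeries (λ cs → ifEmpty w cs + y * weight⁺ cs) ≋ const w ⊕ const y ⊛ treeSeries
    firstChildSeries k = trans (sumList-+ (ifEmpty w) _ (forests (suc k) k))
      (+-cong (forestSeries-ifEmpty w k) (trans (sumList-*ˡ y weight⁺ (forests (suc k) k)) (sym (const-⊛ y treeSeries k))))

  siblingSeries-decomposition : siblingSeries ≋ 1ₛ ⊕ z ⊛ ((const x ⊕ treeSeries) ⊛ siblingSeries)
  siblingSeries-decomposition zero = begin
    siblingsWeight [] + 0#                  ≈⟨ trans (+-identityʳ _) (trans (*-identityˡ _) weight-leaf) ⟩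
    1#                                      ≈⟨ +-identityʳ 1# ⟨
    1# + 0#                                 ≈⟨ +-cong refl (z-⊛-zero ((const x ⊕ treeSeries) ⊛ siblingSeries)) ⟨
    (1ₛ ⊕ z ⊛ ((const x ⊕ treeSeries) ⊛ siblingSeries)) 0 ∎
  siblingSeries-decomposition (suc n) = begin
    siblingSeries (suc n)
      ≈⟨ forestSeries-⊛ (λ cs → ifEmpty x cs + weight⁺ cs) siblingsWeight
           (λ cs rest → trans (siblingsWeight-∷ (node cs) rest) (*-cong (youngerSibling-node cs) refl)) n ⟩
    (forestSeries (λ cs → ifEmpty x cs + weight⁺ cs) ⊛ siblingSeries) n
      ≈⟨ ⊛-cong youngerSiblingSeries (λ _ → refl) n ⟩
    ((const x ⊕ treeSeries) ⊛ siblingSeries) n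
      ≈⟨ trans (+-identityˡ _) (z-⊛-suc _ n) ⟨
    (1ₛ ⊕ z ⊛ ((const x ⊕ treeSeries) ⊛ siblingSeries)) (suc n) ∎
    where
    youngerSiblingSeries : forestSeries (λ cs → ifEmpty x cs + weight⁺ cs) ≋ const x ⊕ treeSeries
    youngerSiblingSeries k = trans (sumList-+ (ifEmpty x) weight⁺ (forests (suc k) k)) (+-cong (forestSeries-ifEmpty x k) refl)

module TreeSeriesEquation (R : CSemiring) (w x y : CommutativeSemiring.Carrier R) where
  open PowerSeries R using (const; z; const-+)
  open TreeSeries R w x y using (treeSeries; siblingSeries; treeSeries-decomposition; siblingSeries-decomposition)
  open SemiringReasoning (PS R)
  private module R = CommutativeSemiring R

  treeSeries-quadratic : treeSeries ≈ z * (const w + const (x R.+ y) * treeSeries + treeSeries * treeSeries)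
  treeSeries-quadratic = begin
    treeSeries
      ≈⟨ treeSeries-decomposition ⟩
    z * (first * siblingSeries)
      ≈⟨ *-cong refl (*-cong refl siblingSeries-decomposition) ⟩
    z * (first * (1# + z * (younger * siblingSeries)))
      ≈⟨ solve 4 (λ Z F Y S → Z :* (F :* (con 1 :+ Z :* (Y :* S))) := Z :* F :+ (Z :* Y) :* (Z :* (F :* S)))
               refl z first younger siblingSeries ⟩
    z * first + (z * younger) * (z * (first * siblingSeries))
      ≈⟨ +-cong refl (*-cong refl treeSeries-decomposition) ⟨
    z * first + (z * younger) * treeSeries
      ≈⟨ solve 5 (λ Z W X Y G → Z :* (W :+ Y :* G) :+ (Z :* (X :+ G)) :* G := Z :* (W :+ (X :+ Y) :* G :+ G :* G))
               refl z (const w) (const x) (const y) treeSeries ⟩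
    z * (const w + (const x + const y) * treeSeries + treeSeries * treeSeries)
      ≈⟨ *-cong refl (+-cong (+-cong refl (*-cong (const-+ x y) refl)) refl) ⟨
    z * (const w + const (x R.+ y) * treeSeries + treeSeries * treeSeries) ∎
    where
    first younger : Carrier
    first   = const w + const y * treeSeries
    younger = const x + treeSeries

-- The derivative of the tree series along the grammar

module DualSeries (R : CSemiring) where
  open SemiringReasoning R
  open PowerSeries R
  module 𝔻 = PowerSeries (Dual R)

  fstₛ sndₛ : 𝔻.Series → Series
  fstₛ F n = proj₁ (F n)
  sndₛ F n = proj₂ (F n)

  fstₛ-⊛ : ∀ F G → fstₛ (F 𝔻.⊛ G) ≋ fstₛ F ⊛ fstₛ G
  fstₛ-⊛ F G zero    = refl
  fstₛ-⊛ F G (suc n) = +-cong refl (fstₛ-⊛ (F ∘ suc) G n)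

  sndₛ-⊛ : ∀ F G → sndₛ (F 𝔻.⊛ G) ≋ fstₛ F ⊛ sndₛ G ⊕ sndₛ F ⊛ fstₛ G
  sndₛ-⊛ F G zero    = refl
  sndₛ-⊛ F G (suc n) = trans (+-cong refl (sndₛ-⊛ (F ∘ suc) G n))
    (solve 4 (λ a b c d → (a :+ b) :+ (c :+ d) := (a :+ c) :+ (b :+ d)) refl _ _ _ _)

  fstₛ-z : fstₛ 𝔻.z ≋ z
  fstₛ-z zero          = refl
  fstₛ-z (suc zero)    = refl
  fstₛ-z (suc (suc n)) = refl

  sndₛ-z : sndₛ 𝔻.z ≋ 0ₛ
  sndₛ-z zero          = refl
  sndₛ-z (suc zero)    = refl
  sndₛ-z (suc (suc n)) = refl

  fstₛ-const : ∀ r → fstₛ (𝔻.const r) ≋ const (proj₁ r)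
  fstₛ-const r zero    = refl
  fstₛ-const r (suc n) = refl

  sndₛ-const : ∀ r → sndₛ (𝔻.const r) ≋ const (proj₂ r)
  sndₛ-const r zero    = refl
  sndₛ-const r (suc n) = refl

  module _ (W S : Carrier × Carrier) (g : 𝔻.Series)
           (g-eq : g 𝔻.≋ 𝔻.z 𝔻.⊛ (𝔻.const W 𝔻.⊕ 𝔻.const S 𝔻.⊛ g 𝔻.⊕ g 𝔻.⊛ g)) where
    private
      a b : Series
      a = fstₛ g
      b = sndₛ g

    fstₛ-quadratic : a ≋ z ⊛ (const (proj₁ W) ⊕ const (proj₁ S) ⊛ a ⊕ a ⊛ a)
    fstₛ-quadratic n = trans (proj₁ (g-eq n)) (trans (fstₛ-⊛ 𝔻.z _ n) (⊛-cong fstₛ-z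
      (λ k → +-cong (+-cong (fstₛ-const W k) (trans (fstₛ-⊛ _ g k) (⊛-cong (fstₛ-const S) (λ _ → refl) k)))
                    (fstₛ-⊛ g g k)) n))

    sndₛ-linear : b ≋ z ⊛ (const (proj₂ W) ⊕ (const (proj₁ S) ⊛ b ⊕ const (proj₂ S) ⊛ a) ⊕ (a ⊛ b ⊕ b ⊛ a))
    sndₛ-linear n = trans (proj₂ (g-eq n)) (trans (sndₛ-⊛ 𝔻.z _ n) (trans (+-cong
      (⊛-cong fstₛ-z (λ k → +-cong (+-cong (sndₛ-const W k)
          (trans (sndₛ-⊛ _ g k) (+-cong (⊛-cong (fstₛ-const S) (λ _ → refl) k) (⊛-cong (sndₛ-const S) (λ _ → refl) k))))
        (sndₛ-⊛ g g k)) n)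
      (trans (⊛-cong sndₛ-z (λ _ → refl) n) (⊛-zeroˡ _ n))) (+-identityʳ _)))

module QuadraticDerivative (R : CSemiring) where
  open PowerSeries R
    using (Series; const; z; θ; θ-cong; θ-⊕; θ-⊛; θ-const; θ-z; Causal; ⊛-causalʳ; ⊛-causalˡ; fixpoint-unique)
  open SemiringReasoning (PS R)
  private module R = CommutativeSemiring R

  module _ (w s c dw ds : R.Carrier) (a b : Series)
           (a-eq  : a ≈ z * (const w + const s * a + a * a))
           (b-eq  : b ≈ z * (const dw + (const s * b + const ds * a) + (a * b + b * a)))
           (dw-eq : const dw ≈ ⌜ 2 ⌝ * (const c * (const w * const s)))
           (ds-eq : const ds ≈ ⌜ 4 ⌝ * (const c * const w)) where
    private
      W S C : Series
      W = const w
      S = const s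
      C = const c

    θ-solution : θ a ≈ a + z * (S * θ a + (θ a * a + a * θ a))
    θ-solution = begin
      θ a                                                      ≈⟨ θ-cong a-eq ⟩
      θ (z * A)                                                ≈⟨ θ-⊛ z A ⟩
      θ z * A + z * θ A                                        ≈⟨ +-cong (*-cong θ-z refl) (*-cong refl θA) ⟩
      z * A + z * ((0# + (0# * a + S * θ a)) + (θ a * a + a * θ a))
                                                               ≈⟨ +-cong a-eq refl ⟨
      a + z * ((0# + (0# * a + S * θ a)) + (θ a * a + a * θ a))
        ≈⟨ solve 4 (λ A T Z S → A :+ Z :* ((con 0 :+ (con 0 :* A :+ S :* T)) :+ (T :* A :+ A :* T))
                              := A :+ Z :* (S :* T :+ (T :* A :+ A :* T))) refl a (θ a) z S ⟩
      a + z * (S * θ a + (θ a * a + a * θ a))                   ∎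
      where
      A : Series
      A = W + S * a + a * a
      θA : θ A ≈ (0# + (0# * a + S * θ a)) + (θ a * a + a * θ a)
      θA = trans (θ-⊕ (W + S * a) (a * a))
             (+-cong (trans (θ-⊕ W (S * a)) (+-cong (θ-const w) (trans (θ-⊛ S a) (+-cong (*-cong (θ-const s) refl) refl))))
                     (θ-⊛ a a))

    -- Differentiating the quadratic equation gives b the closed form P.
    P : Series
    P = ⌜ 2 ⌝ * C * (a * (S + a + θ a))

    P-solves-b-eq : P ≈ z * (const dw + (S * P + const ds * a) + (a * P + P * a))
    P-solves-b-eq = begin
      P
        ≈⟨ solve 4 (λ A T S C → con 2 :* C :* (A :* (S :+ A :+ T)) := con 2 :* C :* A :* (S :+ A) :+ con 2 :* C :* A :* T)
                 refl a (θ a) S C ⟩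
      ⌜ 2 ⌝ * C * a * (S + a) + ⌜ 2 ⌝ * C * a * θ a
        ≈⟨ +-cong refl (*-cong refl θ-solution) ⟩
      ⌜ 2 ⌝ * C * a * (S + a) + ⌜ 2 ⌝ * C * a * (a + z * (S * θ a + (θ a * a + a * θ a)))
        ≈⟨ solve 5 (λ A T S C Z → con 2 :* C :* A :* (S :+ A) :+ con 2 :* C :* A :* (A :+ Z :* (S :* T :+ (T :* A :+ A :* T)))
                                := (con 2 :* C :* (S :+ A :+ A)) :* A :+ Z :* (S :+ A :+ A) :* (con 2 :* C :* A :* T))
                 refl a (θ a) S C z ⟩
      (⌜ 2 ⌝ * C * (S + a + a)) * a + z * (S + a + a) * (⌜ 2 ⌝ * C * a * θ a)
        ≈⟨ +-cong (*-cong refl a-eq) refl ⟩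
      (⌜ 2 ⌝ * C * (S + a + a)) * (z * (W + S * a + a * a)) + z * (S + a + a) * (⌜ 2 ⌝ * C * a * θ a)
        ≈⟨ solve 6 (λ A T S C Z W → (con 2 :* C :* (S :+ A :+ A)) :* (Z :* (W :+ S :* A :+ A :* A)) :+ Z :* (S :+ A :+ A) :* (con 2 :* C :* A :* T)
                                  := Z :* (con 2 :* (C :* (W :* S)) :+ (S :* (con 2 :* C :* (A :* (S :+ A :+ T))) :+ con 4 :* (C :* W) :* A)
                                           :+ (A :* (con 2 :* C :* (A :* (S :+ A :+ T))) :+ (con 2 :* C :* (A :* (S :+ A :+ T))) :* A)))
                 refl a (θ a) S C z W ⟩
      z * (⌜ 2 ⌝ * (C * (W * S)) + (S * P + ⌜ 4 ⌝ * (C * W) * a) + (a * P + P * a))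
        ≈⟨ *-cong refl (+-cong (+-cong dw-eq (+-cong refl (*-cong ds-eq refl))) refl) ⟨
      z * (const dw + (S * P + const ds * a) + (a * P + P * a)) ∎

    b≈P : b ≈ P
    b≈P = fixpoint-unique F F-causal b-eq P-solves-b-eq
      where
      F : Series → Series
      F X = const dw + (S * X + const ds * a) + (a * X + X * a)
      F-causal : Causal F
      F-causal n X Y X≈Y = R.+-cong (R.+-cong R.refl (R.+-cong (⊛-causalʳ S n X≈Y) R.refl))
                                    (R.+-cong (⊛-causalʳ a n X≈Y) (⊛-causalˡ a n X≈Y))

    recurrence-series : C * (θ a + a) ≈ z * (C * (S * θ a) + b + ⌜ 2 ⌝ * (C * W))
    recurrence-series = begin
      C * (θ a + a)
        ≈⟨ *-cong refl (+-cong θ-solution refl) ⟩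
      C * ((a + z * (S * θ a + (θ a * a + a * θ a))) + a)
        ≈⟨ solve 5 (λ A T S C Z → C :* ((A :+ Z :* (S :* T :+ (T :* A :+ A :* T))) :+ A)
                                := con 2 :* C :* A :+ Z :* (C :* (S :* T :+ (T :* A :+ A :* T))))
                 refl a (θ a) S C z ⟩
      ⌜ 2 ⌝ * C * a + z * (C * (S * θ a + (θ a * a + a * θ a)))
        ≈⟨ +-cong (*-cong refl a-eq) refl ⟩
      ⌜ 2 ⌝ * C * (z * (W + S * a + a * a)) + z * (C * (S * θ a + (θ a * a + a * θ a)))
        ≈⟨ solve 6 (λ A T S C Z W → con 2 :* C :* (Z :* (W :+ S :* A :+ A :* A)) :+ Z :* (C :* (S :* T :+ (T :* A :+ A :* T)))
                                  := Z :* (C :* (S :* T) :+ con 2 :* C :* (A :* (S :+ A :+ T)) :+ con 2 :* (C :* W)))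
                 refl a (θ a) S C z W ⟩
      z * (C * (S * θ a) + P + ⌜ 2 ⌝ * (C * W))
        ≈⟨ *-cong refl (+-cong (+-cong refl b≈P) refl) ⟨
      z * (C * (S * θ a) + b + ⌜ 2 ⌝ * (C * W)) ∎

module TreeSeriesDerivative (R : CSemiring) where
  open SemiringReasoning R
  open PowerSeries R
  open ConstSeries R
  open DualSeries R
  private module ℙ = SemiringReasoning (PS R)

  module Along (w x y c dw dx dy : Carrier)
               (dw-eq : dw ≈ ⌜ 2 ⌝ * (c * (w * (x + y))))
               (ds-eq : dx + dy ≈ ⌜ 4 ⌝ * (c * w)) where

    open TreeSeries R w x y using (treeSeries)
    open TreeSeriesEquation R w x y using (treeSeries-quadratic)

    g̃ : 𝔻.Series
    g̃ = TreeSeries.treeSeries (Dual R) (w , dw) (x , dx) (y , dy)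

    private
      a b : Series
      a = fstₛ g̃
      b = sndₛ g̃

      a-eq : a ≋ z ⊛ (const w ⊕ const (x + y) ⊛ a ⊕ a ⊛ a)
      a-eq = fstₛ-quadratic (w , dw) (x + y , dx + dy) g̃
               (TreeSeriesEquation.treeSeries-quadratic (Dual R) (w , dw) (x , dx) (y , dy))

      b-eq : b ≋ z ⊛ (const dw ⊕ (const (x + y) ⊛ b ⊕ const (dx + dy) ⊛ a) ⊕ (a ⊛ b ⊕ b ⊛ a))
      b-eq = sndₛ-linear (w , dw) (x + y , dx + dy) g̃
               (TreeSeriesEquation.treeSeries-quadratic (Dual R) (w , dw) (x , dx) (y , dy))

      dw-eqₛ : const dw ℙ.≈ ℙ.⌜ 2 ⌝ ℙ.* (const c ℙ.* (const w ℙ.* const (x + y)))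
      dw-eqₛ = ℙ.trans (const-cong dw-eq)
        (ℙ.trans (const-⌜⌝* 2 _) (ℙ.*-cong ℙ.refl (ℙ.trans (const-* c _) (ℙ.*-cong ℙ.refl (const-* w _)))))

      ds-eqₛ : const (dx + dy) ℙ.≈ ℙ.⌜ 4 ⌝ ℙ.* (const c ℙ.* const w)
      ds-eqₛ = ℙ.trans (const-cong ds-eq) (ℙ.trans (const-⌜⌝* 4 _) (ℙ.*-cong ℙ.refl (const-* c w)))

      b-recurrence : const c ⊛ (θ a ⊕ a) ≋ z ⊛ (const c ⊛ (const (x + y) ⊛ θ a) ⊕ b ⊕ ℙ.⌜ 2 ⌝ ⊛ (const c ⊛ const w))
      b-recurrence = QuadraticDerivative.recurrence-series R w (x + y) c dw (dx + dy) a b a-eq b-eq dw-eqₛ ds-eqₛ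

    fstₛ-g̃≋treeSeries : fstₛ g̃ ≋ treeSeries
    fstₛ-g̃≋treeSeries = fixpoint-unique F F-causal a-eq treeSeries-quadratic
      where
      F : Series → Series
      F X = const w ⊕ const (x + y) ⊛ X ⊕ X ⊛ X
      F-causal : Causal F
      F-causal n X Y X≈Y = +-cong (+-cong refl (⊛-causalʳ _ n X≈Y))
                                  (trans (⊛-causalˡ X n X≈Y) (⊛-causalʳ Y n X≈Y))

    sndₛ-g̃-recurrence : ∀ m → sndₛ g̃ (suc m) + ⌜ suc m ⌝ * (c * ((x + y) * treeSeries (suc m)))
                   ≈ ⌜ 3 ℕ.+ m ⌝ * (c * treeSeries (2 ℕ.+ m))
    sndₛ-g̃-recurrence m = begin
      b (suc m) + ⌜ suc m ⌝ * (c * ((x + y) * treeSeries (suc m)))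
        ≈⟨ +-cong refl (*-cong refl (*-cong refl (*-cong refl (fstₛ-g̃≋treeSeries (suc m))))) ⟨
      b (suc m) + ⌜ suc m ⌝ * (c * ((x + y) * a (suc m)))
        ≈⟨ via-θ ⟩
      ⌜ 3 ℕ.+ m ⌝ * (c * a (2 ℕ.+ m))
        ≈⟨ *-cong refl (*-cong refl (fstₛ-g̃≋treeSeries (2 ℕ.+ m))) ⟩
      ⌜ 3 ℕ.+ m ⌝ * (c * treeSeries (2 ℕ.+ m)) ∎
      where
      vanishes : (ℙ.⌜ 2 ⌝ ⊛ (const c ⊛ const w)) (suc m) ≈ 0#
      vanishes = sym (ℙ.trans (const-⌜⌝* 2 (c * w)) (ℙ.*-cong ℙ.refl (const-* c w)) (suc m))
      via-θ : b (suc m) + ⌜ suc m ⌝ * (c * ((x + y) * a (suc m))) ≈ ⌜ 3 ℕ.+ m ⌝ * (c * a (2 ℕ.+ m))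
      via-θ = sym (begin
        ⌜ 3 ℕ.+ m ⌝ * (c * a (2 ℕ.+ m))
          ≈⟨ solve 3 (λ N c A → (N :+ con 1) :* (c :* A) := c :* (N :* A :+ A)) refl ⌜ 2 ℕ.+ m ⌝ c (a (2 ℕ.+ m)) ⟩
        c * (θ a (2 ℕ.+ m) + a (2 ℕ.+ m))
          ≈⟨ const-⊛ c (θ a ⊕ a) (2 ℕ.+ m) ⟨
        (const c ⊛ (θ a ⊕ a)) (2 ℕ.+ m)
          ≈⟨ b-recurrence (2 ℕ.+ m) ⟩
        (z ⊛ (const c ⊛ (const (x + y) ⊛ θ a) ⊕ b ⊕ ℙ.⌜ 2 ⌝ ⊛ (const c ⊛ const w))) (2 ℕ.+ m)
          ≈⟨ z-⊛-suc _ (suc m) ⟩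
        (const c ⊛ (const (x + y) ⊛ θ a)) (suc m) + b (suc m) + (ℙ.⌜ 2 ⌝ ⊛ (const c ⊛ const w)) (suc m)
          ≈⟨ +-cong (+-cong (trans (const-⊛ c _ (suc m)) (*-cong refl (const-⊛ (x + y) (θ a) (suc m)))) refl) vanishes ⟩
        c * ((x + y) * (⌜ suc m ⌝ * a (suc m))) + b (suc m) + 0#
          ≈⟨ solve 5 (λ N c s A B → c :* (s :* (N :* A)) :+ B :+ con 0 := B :+ N :* (c :* (s :* A)))
                   refl ⌜ suc m ⌝ c (x + y) (a (suc m)) (b (suc m)) ⟩
        b (suc m) + ⌜ suc m ⌝ * (c * ((x + y) * a (suc m))) ∎)

-- The derivatives of y₂

Ĝ : (R : CSemiring) (w x y : CommutativeSemiring.Carrier R) → ℕ → CommutativeSemiring.Carrier R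
Ĝ R w′ x′ y′ zero    = y′
Ĝ R w′ x′ y′ (suc n) = TreeSeries.treeSeries R w′ x′ y′ (suc n)

y₂-poly : Poly DVar
y₂-poly = (1 , y₂ ∷ []) ∷ []

DerivativeFormula : ℕ → (R : CSemiring) → (DVar → CommutativeSemiring.Carrier R) → Set
DerivativeFormula n R ρ = eval (iterate D n y₂-poly) ≈ ⌜ suc n ! ⌝ * (ρ t ^ n * Ĝ R (ρ w) (ρ x₂) (ρ y₂) n)
  where open SemiringReasoning R
        open Evaluation R ρ

module DerivativeStep (R : CSemiring) (ρ : DVar → CommutativeSemiring.Carrier R) where
  open SemiringReasoning R
  open Evaluation R ρ
  open Derivation R grammar ρ
  open DualNumbers R
  open TreeSeries R (ρ w) (ρ x₂) (ρ y₂) using (treeSeries)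
  open DualSeries R using (sndₛ)

  private
    c = ρ t
    s = ρ x₂ + ρ y₂

  eval-grammar-w : eval (grammar w) ≈ ⌜ 2 ⌝ * (c * (ρ w * s))
  eval-grammar-w = solve 4 (λ c w x y → con 2 :* (c :* (w :* (x :* con 1))) :+ (con 2 :* (c :* (w :* (y :* con 1))) :+ con 0)
                                      := con 2 :* (c :* (w :* (x :+ y)))) refl c (ρ w) (ρ x₂) (ρ y₂)

  eval-grammar-x₂+y₂ : eval (grammar x₂) + eval (grammar y₂) ≈ ⌜ 4 ⌝ * (c * ρ w)
  eval-grammar-x₂+y₂ = solve 2 (λ c w → (con 2 :* (c :* (w :* con 1)) :+ con 0) :+ (con 2 :* (c :* (w :* con 1)) :+ con 0)
                                      := con 4 :* (c :* w)) refl c (ρ w)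

  eval-grammar-t : eval (grammar t) ≈ c * (c * s)
  eval-grammar-t = solve 3 (λ c x y → con 1 :* (c :* (c :* (x :* con 1))) :+ (con 1 :* (c :* (c :* (y :* con 1))) :+ con 0)
                                    := c :* (c :* (x :+ y))) refl c (ρ x₂) (ρ y₂)

  open TreeSeriesDerivative R using (module Along)
  open Along (ρ w) (ρ x₂) (ρ y₂) c _ _ _ eval-grammar-w eval-grammar-x₂+y₂
    using (g̃; fstₛ-g̃≋treeSeries; sndₛ-g̃-recurrence)

  step : ∀ n → DerivativeFormula n (Dual R) ρ̃ → DerivativeFormula (suc n) R ρ
  step zero ih = begin
    eval (D y₂-poly)                                           ≈⟨ eval-derP y₂-poly ⟩
    proj₂ (Ẽ.eval y₂-poly)                                     ≈⟨ proj₂ ih ⟩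
    1# * (1# * eval (grammar y₂) + 0# * ρ y₂) + 0# * (1# * ρ y₂)
      ≈⟨ solve 2 (λ d y → con 1 :* (con 1 :* d :+ con 0 :* y) :+ con 0 :* (con 1 :* y) := d) refl _ (ρ y₂) ⟩
    eval (grammar y₂)
      ≈⟨ solve 2 (λ c w → con 2 :* (c :* (w :* con 1)) :+ con 0
                        := con 2 :* ((c :* con 1) :* ((w :* con 1) :* (con 1 :* con 1) :+ con 0)))
               refl c (ρ w) ⟩
    ⌜ 2 ⌝ * (c ^ 1 * treeSeries 1) ∎
  step (suc m) ih = begin
    eval (D (iterate D (suc m) y₂-poly))
      ≈⟨ eval-derP (iterate D (suc m) y₂-poly) ⟩
    proj₂ (Ẽ.eval (iterate D (suc m) y₂-poly))
      ≈⟨ proj₂ ih ⟩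
    proj₂ (D.⌜ K ⌝ D.* (ρ̃ t D.^ suc m D.* g̃ (suc m)))
      ≈⟨ ε-part ⟩
    (⌜ K ⌝ * c ^ suc m) * (sndₛ g̃ (suc m) + ⌜ suc m ⌝ * (c * (s * treeSeries (suc m))))
      ≈⟨ *-cong refl (sndₛ-g̃-recurrence m) ⟩
    (⌜ K ⌝ * c ^ suc m) * (⌜ 3 ℕ.+ m ⌝ * (c * treeSeries (2 ℕ.+ m)))
      ≈⟨ solve 5 (λ K c P N A → (K :* (c :* P)) :* (N :* (c :* A)) := (N :* K) :* ((c :* (c :* P)) :* A))
               refl ⌜ K ⌝ c (c ^ m) ⌜ 3 ℕ.+ m ⌝ (treeSeries (2 ℕ.+ m)) ⟩
    (⌜ 3 ℕ.+ m ⌝ * ⌜ K ⌝) * (c ^ (2 ℕ.+ m) * treeSeries (2 ℕ.+ m))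
      ≈⟨ *-cong (×1-homo-* (3 ℕ.+ m) K) refl ⟨
    ⌜ (3 ℕ.+ m) ! ⌝ * (c ^ (2 ℕ.+ m) * treeSeries (2 ℕ.+ m)) ∎
    where
    K = (2 ℕ.+ m) !
    cᵐ⁺¹ = ρ̃ t D.^ suc m
    ε-part : proj₂ (D.⌜ K ⌝ D.* (cᵐ⁺¹ D.* g̃ (suc m)))
             ≈ (⌜ K ⌝ * c ^ suc m) * (sndₛ g̃ (suc m) + ⌜ suc m ⌝ * (c * (s * treeSeries (suc m))))
    ε-part = begin
      proj₁ D.⌜ K ⌝ * (proj₁ cᵐ⁺¹ * sndₛ g̃ (suc m) + proj₂ cᵐ⁺¹ * proj₁ (g̃ (suc m)))
        + proj₂ D.⌜ K ⌝ * (proj₁ cᵐ⁺¹ * proj₁ (g̃ (suc m)))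
        ≈⟨ +-cong (*-cong (proj₁-⌜⌝ K) (+-cong (*-cong (proj₁-^ (ρ̃ t) (suc m)) refl)
                                               (*-cong (trans (proj₂-^ (ρ̃ t) m) (*-cong refl (*-cong refl eval-grammar-t)))
                                                       (fstₛ-g̃≋treeSeries (suc m)))))
                  (trans (*-cong (proj₂-⌜⌝ K) refl) (zeroˡ _)) ⟩
      ⌜ K ⌝ * (c ^ suc m * sndₛ g̃ (suc m) + (⌜ suc m ⌝ * (c ^ m * (c * (c * s)))) * treeSeries (suc m)) + 0#
        ≈⟨ solve 7 (λ K c P B N s A → K :* ((c :* P) :* B :+ (N :* (P :* (c :* (c :* s)))) :* A) :+ con 0
                                    := (K :* (c :* P)) :* (B :+ N :* (c :* (s :* A))))
                 refl ⌜ K ⌝ c (c ^ m) (sndₛ g̃ (suc m)) ⌜ suc m ⌝ s (treeSeries (suc m)) ⟩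
      (⌜ K ⌝ * c ^ suc m) * (sndₛ g̃ (suc m) + ⌜ suc m ⌝ * (c * (s * treeSeries (suc m)))) ∎

derivative-formula : ∀ n (R : CSemiring) ρ → DerivativeFormula n R ρ
derivative-formula zero    R ρ = solve 1 (λ y → con 1 :* (y :* con 1) :+ con 0 := con 1 :* (con 1 :* y)) refl (ρ y₂)
  where open SemiringReasoning R
derivative-formula (suc n) R ρ = DerivativeStep.step R ρ n (derivative-formula n (Dual R) (Derivation.ρ̃ R grammar ρ))

oleaf≡oint : ∀ τ → oleaf τ ≡ oint τ
oleafF≡ointF : ∀ cs → oleafF cs ≡ ointF cs
oleaf≡oint (node [])       = ≡.refl
oleaf≡oint (node (c ∷ cs)) = cong (ind (isLeaf c) ℕ.+_) (oleafF≡ointF (c ∷ cs))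
oleafF≡ointF []       = ≡.refl
oleafF≡ointF (c ∷ cs) = cong₂ ℕ._+_ (oleaf≡oint c) (oleafF≡ointF cs)

module TreePolynomial (R : CSemiring) (σ : Var → CommutativeSemiring.Carrier R) where
  open SemiringReasoning R
  open Evaluation R σ
  open Sums R
  open ForestSeries R
  open TreeSeries R (σ X₁ * σ Y₁) (σ X₂) (σ Y₂) using (weight; weight⁺; treeSeries)

  evalWord-replicate : ∀ k v → evalWord (replicate k v) ≈ σ v ^ k
  evalWord-replicate zero    v = refl
  evalWord-replicate (suc k) v = *-cong refl (evalWord-replicate k v)

  evalWord-replicate-++ : ∀ k v u → evalWord (replicate k v ++ u) ≈ σ v ^ k * evalWord u
  evalWord-replicate-++ k v u = trans (evalWord-++ (replicate k v) u) (*-cong (evalWord-replicate k v) refl)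

  -- Every old leaf has an interior parent counted by oint, so x₁ and y₁ always occur together as w.
  evalWord-monoT : ∀ τ → evalWord (monoT τ) ≈ weight τ
  evalWord-monoT τ = begin
    evalWord (monoT τ)
      ≈⟨ trans (evalWord-replicate-++ (oleaf τ) X₁ _) (*-cong refl
           (trans (evalWord-replicate-++ (yleaf τ) X₂ _) (*-cong refl
             (trans (evalWord-replicate-++ (oint τ) Y₁ _) (*-cong refl (evalWord-replicate (yint τ) Y₂)))))) ⟩
    σ X₁ ^ oleaf τ * (σ X₂ ^ yleaf τ * (σ Y₁ ^ oint τ * σ Y₂ ^ yint τ))
      ≡⟨ cong (λ k → σ X₁ ^ oleaf τ * (σ X₂ ^ yleaf τ * (σ Y₁ ^ k * σ Y₂ ^ yint τ))) (≡.sym (oleaf≡oint τ)) ⟩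
    σ X₁ ^ oleaf τ * (σ X₂ ^ yleaf τ * (σ Y₁ ^ oleaf τ * σ Y₂ ^ yint τ))
      ≈⟨ solve 4 (λ a b c d → a :* (b :* (c :* d)) := (a :* c) :* (b :* d)) refl _ _ _ _ ⟩
    (σ X₁ ^ oleaf τ * σ Y₁ ^ oleaf τ) * (σ X₂ ^ yleaf τ * σ Y₂ ^ yint τ)
      ≈⟨ *-cong (^-distrib-* (σ X₁) (σ Y₁) (oleaf τ)) refl ⟨
    weight τ ∎

  private
    eval-terms : ∀ τs → eval (map (λ τ → (1 , monoT τ)) τs) ≈ ∑[ τ ∈ τs ] evalWord (monoT τ)
    eval-terms []       = refl
    eval-terms (τ ∷ τs) = +-cong (*-identityˡ _) (eval-terms τs)

  eval-G : ∀ n → eval (G n) ≈ Ĝ R (σ X₁ * σ Y₁) (σ X₂) (σ Y₂) n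
  eval-G zero    = trans (eval-monomial (Y₂ ∷ [])) (*-identityʳ _)
  eval-G (suc n) = begin
    eval (G (suc n))
      ≈⟨ eval-terms (𝒫 (suc n)) ⟩
    ∑[ τ ∈ 𝒫 (suc n) ] evalWord (monoT τ)
      ≡⟨ sumList-map (evalWord ∘ monoT) node (forests (suc (suc n)) (suc n)) ⟩
    ∑[ cs ∈ forests (suc (suc n)) (suc n) ] evalWord (monoT (node cs))
      ≈⟨ forestSeries-cong (λ c cs → evalWord-monoT (node (c ∷ cs))) n ⟩
    treeSeries (suc n) ∎

module Substitution (R : CSemiring) (σ : Var → CommutativeSemiring.Carrier R) where
  open SemiringReasoning R
  open Evaluation R σ
  private module Ê = Evaluation R

  σ̂ : DVar → Carrier
  σ̂ w  = σ X₁ * σ Y₁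
  σ̂ x₂ = σ X₂
  σ̂ y₂ = σ Y₂
  σ̂ t  = σ T

  evalWord-substVar : ∀ v → evalWord (substVar v) ≈ σ̂ v
  evalWord-substVar w  = *-cong refl (*-identityʳ _)
  evalWord-substVar x₂ = *-identityʳ _
  evalWord-substVar y₂ = *-identityʳ _
  evalWord-substVar t  = *-identityʳ _

  evalWord-subst : ∀ u → evalWord (concatMap substVar u) ≈ Ê.evalWord σ̂ u
  evalWord-subst []      = refl
  evalWord-subst (v ∷ u) = trans (evalWord-++ (substVar v) (concatMap substVar u))
                                 (*-cong (evalWord-substVar v) (evalWord-subst u))

  eval-substW : ∀ p → eval (substW p) ≈ Ê.eval σ̂ p
  eval-substW []            = refl
  eval-substW ((c , u) ∷ p) = +-cong (*-cong refl (evalWord-subst u)) (eval-substW p)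

EqualInEverySemiring : Poly Var → Poly Var → Set₁
EqualInEverySemiring p q = ∀ (R : CSemiring) σ → let open SemiringReasoning R; open Evaluation R σ in eval p ≈ eval q

theorem-in-every-semiring : ∀ n →
  EqualInEverySemiring (substW (iterate D n y₂-poly)) (scaleP (suc n !) (mulP ((1 , replicate n T) ∷ []) (G n)))
theorem-in-every-semiring n R σ = begin
  eval (substW (iterate D n y₂-poly))
    ≈⟨ eval-substW (iterate D n y₂-poly) ⟩
  Evaluation.eval R σ̂ (iterate D n y₂-poly)
    ≈⟨ derivative-formula n R σ̂ ⟩
  ⌜ suc n ! ⌝ * (σ T ^ n * Ĝ R (σ X₁ * σ Y₁) (σ X₂) (σ Y₂) n)
    ≈⟨ *-cong refl (*-cong (trans (eval-monomial (replicate n T)) (evalWord-replicate n T)) (eval-G n)) ⟨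
  ⌜ suc n ! ⌝ * (eval ((1 , replicate n T) ∷ []) * eval (G n))
    ≈⟨ trans (eval-scaleP (suc n !) (mulP ((1 , replicate n T) ∷ []) (G n)))
             (*-cong refl (eval-mulP ((1 , replicate n T) ∷ []) (G n))) ⟨
  eval (scaleP (suc n !) (mulP ((1 , replicate n T) ∷ []) (G n))) ∎
  where
  open SemiringReasoning R
  open Evaluation R σ
  open Substitution R σ
  open TreePolynomial R σ

-- Reading off coefficients

PSⁿ : ℕ → CSemiring
PSⁿ zero    = ℕ.+-*-commutativeSemiring
PSⁿ (suc k) = PS (PSⁿ k)

ℕ[[_]] : ℕ → Set
ℕ[[ k ]] = CommutativeSemiring.Carrier (PSⁿ k)

coeffAt : ∀ {k} → ℕ[[ k ]] → Vec ℕ k → ℕ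
coeffAt {zero}  a []       = a
coeffAt {suc k} f (e ∷ es) = coeffAt (f e) es

var : ∀ {k} → Fin k → ℕ[[ k ]]
var {suc k} zero    = PowerSeries.z (PSⁿ k)
var {suc k} (suc i) = PowerSeries.const (PSⁿ k) (var i)

decrementAt : ∀ {k} → Fin k → Vec ℕ k → Maybe (Vec ℕ k)
decrementAt zero    (zero  ∷ es) = nothing
decrementAt zero    (suc e ∷ es) = just (e ∷ es)
decrementAt (suc i) (e ∷ es)     = Maybe.map (e ∷_) (decrementAt i es)

coeffAt-cong : ∀ {k} {a b : ℕ[[ k ]]} → let open SemiringReasoning (PSⁿ k) in
               a ≈ b → ∀ (e : Vec ℕ k) → coeffAt a e ≡ coeffAt b e
coeffAt-cong {zero}  a≡b []       = a≡b
coeffAt-cong {suc k} a≈b (e ∷ es) = coeffAt-cong (a≈b e) es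

coeffAt-0# : ∀ {k} (e : Vec ℕ k) → coeffAt (SemiringReasoning.0# (PSⁿ k)) e ≡ 0
coeffAt-0# {zero}  []       = ≡.refl
coeffAt-0# {suc k} (e ∷ es) = coeffAt-0# es

coeffAt-+ : ∀ {k} (a b : ℕ[[ k ]]) (e : Vec ℕ k) → let open SemiringReasoning (PSⁿ k) in
            coeffAt (a + b) e ≡ coeffAt a e ℕ.+ coeffAt b e
coeffAt-+ {zero}  a b []       = ≡.refl
coeffAt-+ {suc k} f g (e ∷ es) = coeffAt-+ (f e) (g e) es

coeffAt-⌜⌝* : ∀ {k} c (a : ℕ[[ k ]]) (e : Vec ℕ k) → let open SemiringReasoning (PSⁿ k) in
              coeffAt (⌜ c ⌝ * a) e ≡ c ℕ.* coeffAt a e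
coeffAt-⌜⌝* {zero} c a [] = cong (ℕ._* a) (⌜c⌝≡c c)
  where
  open SemiringReasoning (PSⁿ 0)
  ⌜c⌝≡c : ∀ c → ⌜ c ⌝ ≡ c
  ⌜c⌝≡c zero          = ≡.refl
  ⌜c⌝≡c (suc zero)    = ≡.refl
  ⌜c⌝≡c (suc (suc c)) = ≡.trans (cong (ℕ._+ 1) (⌜c⌝≡c (suc c))) (ℕ.+-comm (suc c) 1)
coeffAt-⌜⌝* {suc k} c f (e ∷ es) = ≡.trans
  (coeffAt-cong (trans (⊛-cong (λ n → sym (const-⌜⌝ c n)) (λ _ → refl) e) (const-⊛ ⌜ c ⌝ f e)) es)
  (coeffAt-⌜⌝* c (f e) es)
  where open SemiringReasoning (PSⁿ k)
        open PowerSeries (PSⁿ k)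
        open ConstSeries (PSⁿ k)

coeffAt-var* : ∀ {k} (i : Fin k) (a : ℕ[[ k ]]) (e : Vec ℕ k) → let open SemiringReasoning (PSⁿ k) in
               coeffAt (var i * a) e ≡ maybe′ (coeffAt a) 0 (decrementAt i e)
coeffAt-var* {suc k} zero    f (zero  ∷ es) = ≡.trans (coeffAt-cong (z-⊛-zero f) es) (coeffAt-0# es)
  where open PowerSeries (PSⁿ k)
coeffAt-var* {suc k} zero    f (suc e ∷ es) = coeffAt-cong (z-⊛-suc f e) es
  where open PowerSeries (PSⁿ k)
coeffAt-var* {suc k} (suc i) f (e ∷ es) = begin
  coeffAt ((const (var i) ⊛ f) e) es                       ≡⟨ coeffAt-cong (const-⊛ (var i) f e) es ⟩
  coeffAt (var i * f e) es                                  ≡⟨ coeffAt-var* i (f e) es ⟩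
  maybe′ (coeffAt (f e)) 0 (decrementAt i es)               ≡⟨ maybe′-map (coeffAt f) 0 (e ∷_) (decrementAt i es) ⟨
  maybe′ (coeffAt f) 0 (Maybe.map (e ∷_) (decrementAt i es)) ∎
  where open SemiringReasoning (PSⁿ k) using (_*_)
        open PowerSeries (PSⁿ k)
        open ≡.≡-Reasoning

infix 4 _≡ᵛ_
_≡ᵛ_ : ∀ {k} → Vec ℕ k → Vec ℕ k → Bool
[]       ≡ᵛ []       = true
(a ∷ as) ≡ᵛ (b ∷ bs) = (a ≡ᵇ b) ∧ (as ≡ᵛ bs)

≡ᵛ-%=suc : ∀ {k} (i : Fin k) (d e : Vec ℕ k) → (d [ i ]%= suc ≡ᵛ e) ≡ maybe′ (d ≡ᵛ_) false (decrementAt i e)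
≡ᵛ-%=suc zero    (d ∷ ds) (zero  ∷ es) = ≡.refl
≡ᵛ-%=suc zero    (d ∷ ds) (suc e ∷ es) = ≡.refl
≡ᵛ-%=suc (suc i) (d ∷ ds) (e ∷ es)     = begin
  (d ≡ᵇ e) ∧ (ds [ i ]%= suc ≡ᵛ es)                          ≡⟨ cong ((d ≡ᵇ e) ∧_) (≡ᵛ-%=suc i ds es) ⟩
  (d ≡ᵇ e) ∧ maybe′ (ds ≡ᵛ_) false (decrementAt i es)         ≡⟨ ∧-maybe′ (decrementAt i es) ⟩
  maybe′ (λ es′ → (d ∷ ds) ≡ᵛ (e ∷ es′)) false (decrementAt i es) ≡⟨ maybe′-map _ false (e ∷_) (decrementAt i es) ⟨
  maybe′ ((d ∷ ds) ≡ᵛ_) false (Maybe.map (e ∷_) (decrementAt i es)) ∎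
  where
  open ≡.≡-Reasoning
  ∧-maybe′ : ∀ m → (d ≡ᵇ e) ∧ maybe′ (ds ≡ᵛ_) false m ≡ maybe′ (λ es′ → (d ≡ᵇ e) ∧ (ds ≡ᵛ es′)) false m
  ∧-maybe′ nothing  = ∧-zeroʳ (d ≡ᵇ e)
  ∧-maybe′ (just _) = ≡.refl

coeffAt-1# : ∀ {k} (e : Vec ℕ k) → coeffAt (SemiringReasoning.1# (PSⁿ k)) e ≡ ind (Vec.replicate k 0 ≡ᵛ e)
coeffAt-1# {zero}  []           = ≡.refl
coeffAt-1# {suc k} (zero  ∷ es) = coeffAt-1# es
coeffAt-1# {suc k} (suc e ∷ es) = coeffAt-0# es

-- Stated for arbitrary k: at k = 5 the type checker unfolds ℕ[[ 5 ]] to ℕ → ⋯ → ℕ when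
-- comparing evaluations, which is prohibitively slow.
module CoefficientExtraction {k} (index : Var → Fin k) where
  generic : Var → ℕ[[ k ]]
  generic v = var (index v)

  open Evaluation (PSⁿ k) generic
  open SemiringReasoning (PSⁿ k) using (_+_; _*_; ⌜_⌝)

  exponents : List Var → Vec ℕ k
  exponents []      = Vec.replicate k 0
  exponents (v ∷ u) = exponents u [ index v ]%= suc

  coeffAt-evalWord : ∀ u (e : Vec ℕ k) → coeffAt (evalWord u) e ≡ ind (exponents u ≡ᵛ e)
  coeffAt-evalWord []      e = coeffAt-1# e
  coeffAt-evalWord (v ∷ u) e = begin
    coeffAt (generic v * evalWord u) e                                ≡⟨ coeffAt-var* (index v) (evalWord u) e ⟩
    maybe′ (coeffAt (evalWord u)) 0 (decrementAt (index v) e)         ≡⟨ under-maybe′ (decrementAt (index v) e) ⟩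
    ind (maybe′ (exponents u ≡ᵛ_) false (decrementAt (index v) e))   ≡⟨ cong ind (≡ᵛ-%=suc (index v) (exponents u) e) ⟨
    ind (exponents u [ index v ]%= suc ≡ᵛ e)                          ∎
    where
    open ≡.≡-Reasoning
    under-maybe′ : ∀ m → maybe′ (coeffAt (evalWord u)) 0 m ≡ ind (maybe′ (exponents u ≡ᵛ_) false m)
    under-maybe′ nothing   = ≡.refl
    under-maybe′ (just e′) = coeffAt-evalWord u e′

  module _ (sameMono-exponents : ∀ u m → sameMono u m ≡ (exponents u ≡ᵛ exponents m)) where

    coeff-eval : ∀ p m → coeff p m ≡ coeffAt (eval p) (exponents m)
    coeff-eval []            m = ≡.sym (coeffAt-0# (exponents m))
    coeff-eval ((c , u) ∷ p) m = ≡.sym (begin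
      coeffAt (⌜ c ⌝ * evalWord u + eval p) (exponents m)
        ≡⟨ coeffAt-+ (⌜ c ⌝ * evalWord u) (eval p) (exponents m) ⟩
      coeffAt (⌜ c ⌝ * evalWord u) (exponents m) ℕ.+ coeffAt (eval p) (exponents m)
        ≡⟨ cong₂ ℕ._+_ (≡.trans (coeffAt-⌜⌝* c (evalWord u) (exponents m)) (cong (c ℕ.*_) (coeffAt-evalWord u (exponents m))))
                       (≡.sym (coeff-eval p m)) ⟩
      c ℕ.* ind (exponents u ≡ᵛ exponents m) ℕ.+ coeff p m
        ≡⟨ cong (λ b → c ℕ.* ind b ℕ.+ coeff p m) (sameMono-exponents u m) ⟨
      c ℕ.* ind (sameMono u m) ℕ.+ coeff p m
        ≡⟨ cong (ℕ._+ coeff p m) (*-ind (sameMono u m)) ⟩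
      (if sameMono u m then c else 0) ℕ.+ coeff p m ∎)
      where
      open ≡.≡-Reasoning
      *-ind : ∀ b → c ℕ.* ind b ≡ (if b then c else 0)
      *-ind true  = ℕ.*-identityʳ c
      *-ind false = ℕ.*-zeroʳ c

    equal-coefficients : ∀ {p q} → EqualInEverySemiring p q → p ≈P q
    equal-coefficients {p} {q} p=q m = begin
      coeff p m                        ≡⟨ coeff-eval p m ⟩
      coeffAt (eval p) (exponents m)   ≡⟨ coeffAt-cong (p=q (PSⁿ k) generic) (exponents m) ⟩
      coeffAt (eval q) (exponents m)   ≡⟨ coeff-eval q m ⟨
      coeff q m                        ∎
      where open ≡.≡-Reasoning

index : Var → Fin 5
index X₁ = zero
index Y₁ = suc zero
index X₂ = suc (suc zero)
index Y₂ = suc (suc (suc zero))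
index T  = suc (suc (suc (suc zero)))

counts : List Var → Vec ℕ 5
counts u = count X₁ u ∷ count Y₁ u ∷ count X₂ u ∷ count Y₂ u ∷ count T u ∷ []

open CoefficientExtraction index using (exponents; equal-coefficients)

exponents≡counts : ∀ u → exponents u ≡ counts u
exponents≡counts []      = ≡.refl
exponents≡counts (v ∷ u) = ≡.trans (cong (_[ index v ]%= suc) (exponents≡counts u)) (counts-∷ v)
  where
  counts-∷ : ∀ v → counts u [ index v ]%= suc ≡ counts (v ∷ u)
  counts-∷ X₁ = ≡.refl
  counts-∷ Y₁ = ≡.refl
  counts-∷ X₂ = ≡.refl
  counts-∷ Y₂ = ≡.refl
  counts-∷ T  = ≡.refl

sameMono-exponents : ∀ u m → sameMono u m ≡ (exponents u ≡ᵛ exponents m)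
sameMono-exponents u m = begin
  sameMono u m                  ≡⟨ cong (λ b → (count X₁ u ≡ᵇ count X₁ m) ∧ (count Y₁ u ≡ᵇ count Y₁ m)
                                              ∧ (count X₂ u ≡ᵇ count X₂ m) ∧ (count Y₂ u ≡ᵇ count Y₂ m) ∧ b)
                                       (∧-identityʳ (count T u ≡ᵇ count T m)) ⟨
  counts u ≡ᵛ counts m          ≡⟨ cong₂ _≡ᵛ_ (exponents≡counts u) (exponents≡counts m) ⟨
  exponents u ≡ᵛ exponents m   ∎
  where open ≡.≡-Reasoning

theorem1p21 : (n : ℕ) →
    substW (iterate D n ((1 , y₂ ∷ []) ∷ []))
      ≈P scaleP (suc n !) (mulP ((1 , replicate n T) ∷ []) (G n))
theorem1p21 n = equal-coefficients sameMono-exponents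
  {substW (iterate D n y₂-poly)} {scaleP (suc n !) (mulP ((1 , replicate n T) ∷ []) (G n))}
  (theorem-in-every-semiring n)
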